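{- If $n \geq 6$, then the strip graph $G_n$ satisfies $\operatorname{gon}(G_n) \geq 4$.
   Context: The strip graph $G_n$ has vertices $v_0,\ldots,v_n$ and an edge between $v_i$ and $v_j$ exactly when $|i-j|\in\{1,2\}$. For a finite connected graph, divisors are integer combinations of vertices, equivalent when their difference lies in the image of the graph Laplacian; the rank of $D$ is $-1$ if $D$ is not equivalent to an effective divisor, otherwise the largest $r$ such that $D-E$ is equivalent to an effective divisor for all effective $E$ of degree $r$. The gonality $\operatorname{gon}(G)$ is the minimum degree of a divisor of rank at least $1$. -}

module Defs where

open import Data.Nat as ℕ using (ℕ; zero; suc; ∣_-_∣; _≡ᵇ_)
open import Data.Fin using (Fin; toℕ)
import Data.Fin as Fin
open import Data.Bool using (Bool; true; false; _∨_)
open import Data.Integer using (ℤ; _+_; _-_; _≤_; +_)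
open import Data.Product using (Σ; _×_)
open import Relation.Binary.PropositionalEquality using (_≡_)

-- A finite (loopless, undirected) graph on vertex set Fin m, given by a
-- symmetric Boolean adjacency function.
record Graph : Set where
  field
    size : ℕ
    adj  : Fin size → Fin size → Bool
open Graph public

sumFin : ∀ {m} → (Fin m → ℤ) → ℤ
sumFin {zero}  f = + 0
sumFin {suc m} f = f Fin.zero + sumFin (λ i → f (Fin.suc i))

Divisor : Graph → Set
Divisor G = Fin (size G) → ℤ

deg : ∀ {G} → Divisor G → ℤ
deg D = sumFin D

Effective : ∀ {G} → Divisor G → Set
Effective D = ∀ v → + 0 ≤ D v

_-ᴰ_ : ∀ {G} → Divisor G → Divisor G → Divisor G
(D -ᴰ E) v = D v - E v

indicator : Bool → ℤ → ℤ
indicator true  x = x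
indicator false _ = + 0

-- Graph Laplacian applied to f : (L f)(v) = deg(v) f(v) - Σ_{w ~ v} f(w)
--                                      = Σ_{w ~ v} (f(v) - f(w)).
laplacian : (G : Graph) → (Fin (size G) → ℤ) → Divisor G
laplacian G f v = sumFin (λ w → indicator (adj G v w) (f v - f w))

_∼_ : ∀ {G} → Divisor G → Divisor G → Set
_∼_ {G} D D' = Σ (Fin (size G) → ℤ) λ f → ∀ v → _-ᴰ_ {G} D D' v ≡ laplacian G f v

EquivEffective : ∀ {G} → Divisor G → Set
EquivEffective {G} D = Σ (Divisor G) λ D' → Effective {G} D' × (_∼_ {G} D D')

-- rank(D) ≥ r (for r ≥ 0): D is equivalent to an effective divisor
-- (so rank ≠ -1), and D - E is equivalent to an effective divisor for every
-- effective E of degree r.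
RankAtLeast : ∀ {G} → Divisor G → ℕ → Set
RankAtLeast {G} D r =
  EquivEffective {G} D ×
  (∀ (E : Divisor G) → Effective {G} E → deg {G} E ≡ + r →
     EquivEffective {G} (_-ᴰ_ {G} D E))

-- gon(G) ≥ k : every divisor of rank at least 1 has degree at least k
-- (gon is the minimum degree of such divisors).
GonalityAtLeast : Graph → ℤ → Set
GonalityAtLeast G k = ∀ (D : Divisor G) → RankAtLeast {G} D 1 → k ≤ deg {G} D

strip : ℕ → Graph
strip n = record
  { size = suc n
  ; adj  = λ i j → (∣ toℕ i - toℕ j ∣ ≡ᵇ 1) ∨ (∣ toℕ i - toℕ j ∣ ≡ᵇ 2)
  }

-- Let D be effective of degree at most 3 with every D - q equivalent to an effective divisor.
-- If D has no chip at q, write that divisor as D - q - L h; the set where h is maximal can then be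
-- fired legally without containing q. On the strip a fired vertex pays one chip per neighbour
-- outside the fired set, so with three chips the fired set is, up to reflection, {0}, {1}, an
-- initial segment, or all vertices but 1 or n, each forcing chips in a specific pattern. Every
-- pattern is excluded by firing a segment, by reflecting, or by asking for another empty vertex
-- whose legal firings would all need a fourth chip.

{-# OPTIONS --safe #-}
module Submission where

open import Defs
open import Data.Nat using (ℕ; _≤_)
open import Data.Integer using (+_)

import Algebra.Properties.CommutativeMonoid.Sum as CommutativeMonoidSum
open import Data.Bool using (Bool; true; false; not; _∨_; _∧_; T; if_then_else_) renaming (_≟_ to _≟ᵇ_)
open import Data.Bool.Properties using (¬-not)
open import Data.Empty using (⊥; ⊥-elim)
open import Data.Fin as Fin using (Fin; zero; suc; toℕ; opposite)
import Data.Fin.Properties as FinP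
open import Data.Fin.Patterns using (0F; 1F; 2F; 3F; 4F)
open import Data.Fin.Permutation using (reverse)
open import Data.Integer as ℤ using (ℤ; -[1+_]; -_)
  renaming (_+_ to _+ᶻ_; _-_ to _-ᶻ_; _≤_ to _≤ᶻ_; _<_ to _<ᶻ_)
import Data.Integer.Properties as ℤP
open import Data.Integer.Solver using (module +-*-Solver)
open import Data.List using ([]; _∷_; map)
open import Data.Nat.ListAction using (sum)
open import Data.List.Relation.Unary.All as All using (All; []; _∷_)
open import Data.List.Relation.Unary.AllPairs using ([]; _∷_)
open import Data.List.Relation.Unary.Unique.Propositional using (Unique)
open import Data.List.Relation.Unary.Unique.Propositional.Properties using (map⁺)
open import Data.List.Relation.Binary.Pointwise using (Pointwise; []; _∷_)
open import Data.Nat as ℕ using (zero; suc; _+_; _∸_; _<_; z≤n; s≤s; _≤ᵇ_; _<ᵇ_; _≡ᵇ_)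
import Data.Nat.Properties as ℕP
open import Data.List.Relation.Unary.Unique.DecPropositional ℕ._≟_ using (unique?)
open import Data.Product using (∃-syntax; _×_; _,_; proj₁; proj₂)
open import Data.Sum using (_⊎_; inj₁; inj₂)
open import Function using (_∘_)
open import Relation.Binary.PropositionalEquality
  using (_≡_; _≢_; _≗_; refl; sym; trans; cong; cong₂; subst; module ≡-Reasoning)
open import Relation.Nullary using (Dec; does; yes; no)
open import Relation.Nullary.Decidable using (True; toWitness; dec-true; dec-false)

open +-*-Solver using (solve; _:+_; _:-_; :-_; _:=_; con)

module ℤΣ = CommutativeMonoidSum ℤP.+-0-commutativeMonoid
module ℕΣ = CommutativeMonoidSum ℕP.+-0-commutativeMonoid
open import Algebra.Properties.CommutativeSemigroup ℕP.+-commutativeSemigroup using (x∙yz≈y∙xz)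

-- Sums over vertices

sumFin≡sum : ∀ {k} (f : Fin k → ℤ) → sumFin f ≡ ℤΣ.sum f
sumFin≡sum {zero}  f = refl
sumFin≡sum {suc k} f = cong (f zero +ᶻ_) (sumFin≡sum (f ∘ suc))

sumFin-cong : ∀ {k} {f g : Fin k → ℤ} → f ≗ g → sumFin f ≡ sumFin g
sumFin-cong {f = f} {g} f≗g = begin
  sumFin f     ≡⟨ sumFin≡sum f ⟩
  ℤΣ.sum f     ≡⟨ ℤΣ.sum-cong-≗ f≗g ⟩
  ℤΣ.sum g     ≡⟨ sumFin≡sum g ⟨
  sumFin g     ∎
  where open ≡-Reasoning

sumFin-distrib-+ : ∀ {k} (f g : Fin k → ℤ) → sumFin (λ v → f v +ᶻ g v) ≡ sumFin f +ᶻ sumFin g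
sumFin-distrib-+ f g = begin
  sumFin (λ v → f v +ᶻ g v)   ≡⟨ sumFin≡sum (λ v → f v +ᶻ g v) ⟩
  ℤΣ.sum (λ v → f v +ᶻ g v)   ≡⟨ ℤΣ.∑-distrib-+ f g ⟩
  ℤΣ.sum f +ᶻ ℤΣ.sum g        ≡⟨ cong₂ _+ᶻ_ (sumFin≡sum f) (sumFin≡sum g) ⟨
  sumFin f +ᶻ sumFin g        ∎
  where open ≡-Reasoning

sumFin-neg : ∀ {k} (f : Fin k → ℤ) → sumFin (λ v → - f v) ≡ - sumFin f
sumFin-neg {zero}  f = refl
sumFin-neg {suc k} f = trans (cong (- f zero +ᶻ_) (sumFin-neg (f ∘ suc)))
                             (sym (ℤP.neg-distrib-+ (f zero) _))

sumFin-distrib-- : ∀ {k} (f g : Fin k → ℤ) → sumFin (λ v → f v -ᶻ g v) ≡ sumFin f -ᶻ sumFin g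
sumFin-distrib-- f g =
  trans (sumFin-distrib-+ f (λ v → - g v)) (cong (sumFin f +ᶻ_) (sumFin-neg g))

sumFin-comm : ∀ {k l} (f : Fin k → Fin l → ℤ) →
              sumFin (λ v → sumFin (f v)) ≡ sumFin (λ w → sumFin (λ v → f v w))
sumFin-comm f = begin
  sumFin (λ v → sumFin (f v))            ≡⟨ sumFin-cong (λ v → sumFin≡sum (f v)) ⟩
  sumFin (λ v → ℤΣ.sum (f v))            ≡⟨ sumFin≡sum (λ v → ℤΣ.sum (f v)) ⟩
  ℤΣ.sum (λ v → ℤΣ.sum (f v))            ≡⟨ ℤΣ.∑-comm f ⟩
  ℤΣ.sum (λ w → ℤΣ.sum (λ v → f v w))    ≡⟨ sumFin≡sum (λ w → ℤΣ.sum (λ v → f v w)) ⟨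
  sumFin (λ w → ℤΣ.sum (λ v → f v w))    ≡⟨ sumFin-cong (λ w → sumFin≡sum (λ v → f v w)) ⟨
  sumFin (λ w → sumFin (λ v → f v w))    ∎
  where open ≡-Reasoning

sumFin-opposite : ∀ {k} (f : Fin k → ℤ) → sumFin (f ∘ opposite) ≡ sumFin f
sumFin-opposite f = begin
  sumFin (f ∘ opposite)   ≡⟨ sumFin≡sum (f ∘ opposite) ⟩
  ℤΣ.sum (f ∘ opposite)   ≡⟨ ℤΣ.sum-permute f reverse ⟨
  ℤΣ.sum f                ≡⟨ sumFin≡sum f ⟨
  sumFin f                ∎
  where open ≡-Reasoning

sumFin-mono : ∀ {k} {f g : Fin k → ℤ} → (∀ v → f v ≤ᶻ g v) → sumFin f ≤ᶻ sumFin g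
sumFin-mono {zero}  f≤g = ℤP.≤-refl
sumFin-mono {suc k} f≤g = ℤP.+-mono-≤ (f≤g zero) (sumFin-mono (f≤g ∘ suc))

sumFin-zero : ∀ k → sumFin {k} (λ _ → + 0) ≡ + 0
sumFin-zero k = trans (sumFin≡sum {k} _) (ℤΣ.sum-replicate-zero k)

sumFin-nonneg : ∀ {k} {f : Fin k → ℤ} → (∀ v → + 0 ≤ᶻ f v) → + 0 ≤ᶻ sumFin f
sumFin-nonneg {k} {f} f≥0 = subst (_≤ᶻ sumFin f) (sumFin-zero k) (sumFin-mono f≥0)

sumFin-nonpos : ∀ {k} {f : Fin k → ℤ} → (∀ v → f v ≤ᶻ + 0) → sumFin f ≤ᶻ + 0
sumFin-nonpos {k} {f} f≤0 = subst (sumFin f ≤ᶻ_) (sumFin-zero k) (sumFin-mono f≤0)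

indicator-sub : ∀ b x y → indicator b (x -ᶻ y) ≡ indicator b x -ᶻ indicator b y
indicator-sub true  x y = refl
indicator-sub false x y = refl

indicator-neg : ∀ b x → indicator b (- x) ≡ - indicator b x
indicator-neg true  x = refl
indicator-neg false x = refl

indicator-mono : ∀ b {x y} → x ≤ᶻ y → indicator b x ≤ᶻ indicator b y
indicator-mono true  x≤y = x≤y
indicator-mono false x≤y = ℤP.≤-refl

indicator-nonneg : ∀ b {x} → + 0 ≤ᶻ x → + 0 ≤ᶻ indicator b x
indicator-nonneg true  0≤x = 0≤x
indicator-nonneg false 0≤x = ℤP.≤-refl

indicator-nonpos : ∀ b {x} → x ≤ᶻ + 0 → indicator b x ≤ᶻ + 0
indicator-nonpos true  x≤0 = x≤0
indicator-nonpos false x≤0 = ℤP.≤-refl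

-- Laplacian, linear equivalence and legal firings

0≤i-j : ∀ {i j} → + 0 ≤ᶻ i → j ≤ᶻ + 0 → + 0 ≤ᶻ i -ᶻ j
0≤i-j 0≤i j≤0 = ℤP.+-mono-≤ 0≤i (ℤP.neg-mono-≤ j≤0)

1≤j-i : ∀ {i j} → i <ᶻ j → + 1 ≤ᶻ j -ᶻ i
1≤j-i {i} {j} i<j = subst (_≤ᶻ j -ᶻ i) (cancel i) (ℤP.+-monoˡ-≤ (- i) (ℤP.i<j⇒suc[i]≤j i<j))
  where
  cancel : ∀ i → (+ 1 +ᶻ i) -ᶻ i ≡ + 1
  cancel = solve 1 (λ i → (con (+ 1) :+ i) :- i := con (+ 1)) refl

laplacian-sub : ∀ G (f g : Fin (size G) → ℤ) v →
                laplacian G (λ w → f w -ᶻ g w) v ≡ laplacian G f v -ᶻ laplacian G g v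
laplacian-sub G f g v = begin
  sumFin (λ w → indicator (adj G v w) ((f v -ᶻ g v) -ᶻ (f w -ᶻ g w)))
    ≡⟨ sumFin-cong (λ w → trans (cong (indicator (adj G v w)) (interchange (f v) (g v) (f w) (g w)))
                                (indicator-sub (adj G v w) _ _)) ⟩
  sumFin (λ w → indicator (adj G v w) (f v -ᶻ f w) -ᶻ indicator (adj G v w) (g v -ᶻ g w))
    ≡⟨ sumFin-distrib-- (λ w → indicator (adj G v w) (f v -ᶻ f w))
                        (λ w → indicator (adj G v w) (g v -ᶻ g w)) ⟩
  laplacian G f v -ᶻ laplacian G g v ∎
  where
  open ≡-Reasoning
  interchange : ∀ a b c d → (a -ᶻ b) -ᶻ (c -ᶻ d) ≡ (a -ᶻ c) -ᶻ (b -ᶻ d)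
  interchange = solve 4 (λ a b c d → (a :- b) :- (c :- d) := (a :- c) :- (b :- d)) refl

Symmetric : Graph → Set
Symmetric G = ∀ v w → adj G v w ≡ adj G w v

self-negating⇒zero : ∀ {x} → x ≡ - x → x ≡ + 0
self-negating⇒zero {+ zero}    _  = refl
self-negating⇒zero {+ suc _}   ()
self-negating⇒zero { -[1+ _ ]} ()

-- Every edge {v,w} contributes f v - f w to the row of v and f w - f v to the row of w.
deg-laplacian : ∀ G → Symmetric G → ∀ f → deg {G} (laplacian G f) ≡ + 0
deg-laplacian G sym-adj f = self-negating⇒zero (begin
  sumFin (λ v → sumFin (flow v))          ≡⟨ sumFin-comm flow ⟩
  sumFin (λ w → sumFin (λ v → flow v w))  ≡⟨ sumFin-cong (λ w → sumFin-cong (antisymmetric w)) ⟩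
  sumFin (λ w → sumFin (λ v → - flow w v)) ≡⟨ sumFin-cong (λ w → sumFin-neg (flow w)) ⟩
  sumFin (λ w → - sumFin (flow w))        ≡⟨ sumFin-neg (λ v → sumFin (flow v)) ⟩
  - sumFin (λ v → sumFin (flow v))        ∎)
  where
  open ≡-Reasoning
  flow : Fin (size G) → Fin (size G) → ℤ
  flow v w = indicator (adj G v w) (f v -ᶻ f w)
  antisymmetric : ∀ w v → flow v w ≡ - flow w v
  antisymmetric w v =
    trans (cong₂ indicator (sym-adj v w) (swap (f v) (f w))) (indicator-neg (adj G w v) _)
    where
    swap : ∀ a b → a -ᶻ b ≡ - (b -ᶻ a)
    swap = solve 2 (λ a b → a :- b := :- (b :- a)) refl

∼⇒deg≡ : ∀ G → Symmetric G → {D D' : Divisor G} → _∼_ {G} D D' → deg {G} D ≡ deg {G} D'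
∼⇒deg≡ G sym-adj {D} {D'} (f , D-D'≡Lf) = ℤP.i-j≡0⇒i≡j _ _ (begin
  sumFin D -ᶻ sumFin D'         ≡⟨ sumFin-distrib-- D D' ⟨
  sumFin (λ v → D v -ᶻ D' v)    ≡⟨ sumFin-cong D-D'≡Lf ⟩
  sumFin (laplacian G f)        ≡⟨ deg-laplacian G sym-adj f ⟩
  + 0                           ∎)
  where open ≡-Reasoning

∼-minus-laplacian : ∀ G (D : Divisor G) f → _∼_ {G} D (λ v → D v -ᶻ laplacian G f v)
∼-minus-laplacian G D f = f , λ v → cancel (D v) (laplacian G f v)
  where
  cancel : ∀ a b → a -ᶻ (a -ᶻ b) ≡ b
  cancel = solve 2 (λ a b → a :- (a :- b) := b) refl

point : ∀ {k} → Fin k → Fin k → ℤ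
point q v = indicator (does (v Fin.≟ q)) (+ 1)

point-nonneg : ∀ {k} (q v : Fin k) → + 0 ≤ᶻ point q v
point-nonneg q v = indicator-nonneg (does (v Fin.≟ q)) (ℤ.+≤+ z≤n)

point-self : ∀ {k} (q : Fin k) → point q q ≡ + 1
point-self q = cong (λ b → indicator b (+ 1)) (dec-true (q Fin.≟ q) refl)

deg-point : ∀ {k} (q : Fin k) → sumFin (point q) ≡ + 1
deg-point {suc k} zero    = cong (+ 1 +ᶻ_) (sumFin-zero k)
deg-point {suc k} (suc q) = trans (ℤP.+-identityˡ _) (deg-point q)

ReachesEveryVertex : ∀ {G} → Divisor G → Set
ReachesEveryVertex {G} D = ∀ q → EquivEffective {G} (_-ᴰ_ {G} D (point q))

rank≥1⇒reachesEveryVertex : ∀ {G} {D : Divisor G} → RankAtLeast {G} D 1 → ReachesEveryVertex {G} D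
rank≥1⇒reachesEveryVertex (_ , moves) q = moves (point q) (point-nonneg q) (deg-point q)

reachesEveryVertex-resp-∼ : ∀ G {D D' : Divisor G} → _∼_ {G} D D' →
                            ReachesEveryVertex {G} D → ReachesEveryVertex {G} D'
reachesEveryVertex-resp-∼ G {D} {D'} (f , D-D'≡Lf) reach q with reach q
... | E , E≥0 , h , D-q-E≡Lh = E , E≥0 , (λ w → h w -ᶻ f w) , λ v → begin
  (D' v -ᶻ point q v) -ᶻ E v                    ≡⟨ shift (D v) (D' v) (point q v) (E v) ⟩
  ((D v -ᶻ point q v) -ᶻ E v) -ᶻ (D v -ᶻ D' v)  ≡⟨ cong₂ _-ᶻ_ (D-q-E≡Lh v) (D-D'≡Lf v) ⟩
  laplacian G h v -ᶻ laplacian G f v            ≡⟨ laplacian-sub G h f v ⟨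
  laplacian G (λ w → h w -ᶻ f w) v              ∎
  where
  open ≡-Reasoning
  shift : ∀ d d' p e → (d' -ᶻ p) -ᶻ e ≡ ((d -ᶻ p) -ᶻ e) -ᶻ (d -ᶻ d')
  shift = solve 4 (λ d d' p e → (d' :- p) :- e := ((d :- p) :- e) :- (d :- d')) refl

χ : ∀ {k} → (Fin k → Bool) → Fin k → ℤ
χ A v = indicator (A v) (+ 1)

LegalFiring : ∀ G → Divisor G → (Fin (size G) → Bool) → Set
LegalFiring G D A = Effective {G} (_-ᴰ_ {G} D (laplacian G (χ A)))

argmax : ∀ {k} (h : Fin k → ℤ) → Fin k → ∃[ w ] (∀ v → h v ≤ᶻ h w)
argmax {suc zero}    h _ = zero , λ { zero → ℤP.≤-refl }
argmax {suc (suc k)} h _ with argmax (h ∘ suc) zero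
... | w , max with ℤP.≤-total (h zero) (h (suc w))
...   | inj₁ h₀≤ = suc w , λ { zero → h₀≤ ; (suc v) → max v }
...   | inj₂ ≤h₀ = zero  , λ { zero → ℤP.≤-refl ; (suc v) → ℤP.≤-trans (max v) ≤h₀ }

-- With D - q - L h ≥ 0, the set where h is maximal can be fired legally and misses q.
legalFiring-avoiding : ∀ G {D : Divisor G} → Effective {G} D → ∀ q → D q ≡ + 0 →
                       EquivEffective {G} (_-ᴰ_ {G} D (point q)) →
                       ∃[ A ] (A q ≡ false × (∃[ v ] A v ≡ true) × LegalFiring G D A)
legalFiring-avoiding G {D} D≥0 q Dq≡0 (E , E≥0 , h , D-q-E≡Lh) =
  A , q∉A , (top , dec-true (h top ℤ.≟ h top) refl) , legal
  where
  top : Fin (size G)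
  top = proj₁ (argmax h q)
  h≤top : ∀ v → h v ≤ᶻ h top
  h≤top = proj₂ (argmax h q)
  A : Fin (size G) → Bool
  A v = does (h v ℤ.≟ h top)

  Lh≤D-q : ∀ v → laplacian G h v ≤ᶻ D v -ᶻ point q v
  Lh≤D-q v = subst (_≤ᶻ _) (D-q-E≡Lh v) (ℤP.i-j≤i _ (E v) {{ℤ.nonNegative (E≥0 v)}})

  Lh-top-nonneg : ∀ v → h v ≡ h top → + 0 ≤ᶻ laplacian G h v
  Lh-top-nonneg v hv≡top = sumFin-nonneg λ u →
    indicator-nonneg (adj G v u) (ℤP.i≤j⇒0≤j-i (subst (h u ≤ᶻ_) (sym hv≡top) (h≤top u)))

  q∉A : A q ≡ false
  q∉A = dec-false (h q ℤ.≟ h top) λ hq≡top → ℤP.<-irrefl refl (begin-strict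
    + 0                     ≤⟨ Lh-top-nonneg q hq≡top ⟩
    laplacian G h q         ≤⟨ Lh≤D-q q ⟩
    D q -ᶻ point q q        ≡⟨ cong₂ _-ᶻ_ Dq≡0 (point-self q) ⟩
    - + 1                   <⟨ ℤ.-<+ ⟩
    + 0                     ∎)
    where open ℤP.≤-Reasoning

  χ-gap-top : ∀ v u → h v ≡ h top → χ A v -ᶻ χ A u ≤ᶻ h v -ᶻ h u
  χ-gap-top v u hv≡top rewrite dec-true (h v ℤ.≟ h top) hv≡top with h u ℤ.≟ h top
  ... | yes hu≡top = ℤP.i≤j⇒0≤j-i (ℤP.≤-reflexive (trans hu≡top (sym hv≡top)))
  ... | no  hu≢top = 1≤j-i (subst (h u <ᶻ_) (sym hv≡top) (ℤP.≤∧≢⇒< (h≤top u) hu≢top))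

  χ-gap-rest : ∀ v u → A v ≡ false → χ A v -ᶻ χ A u ≤ᶻ + 0
  χ-gap-rest v u v∉A rewrite v∉A with A u
  ... | true  = ℤ.-≤+
  ... | false = ℤP.≤-refl

  legal : LegalFiring G D A
  legal v = legal-by (h v ℤ.≟ h top)
    where
    open ℤP.≤-Reasoning
    legal-by : Dec (h v ≡ h top) → + 0 ≤ᶻ D v -ᶻ laplacian G (χ A) v
    legal-by (yes hv≡top) = ℤP.i≤j⇒0≤j-i (begin
      laplacian G (χ A) v  ≤⟨ sumFin-mono (λ u → indicator-mono (adj G v u) (χ-gap-top v u hv≡top)) ⟩
      laplacian G h v      ≤⟨ Lh≤D-q v ⟩
      D v -ᶻ point q v     ≤⟨ ℤP.i-j≤i (D v) (point q v) {{ℤ.nonNegative (point-nonneg q v)}} ⟩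
      D v                  ∎)
    legal-by (no hv≢top) = 0≤i-j (D≥0 v) (sumFin-nonpos λ u →
      indicator-nonpos (adj G v u) (χ-gap-rest v u (dec-false (h v ℤ.≟ h top) hv≢top)))

-- The strip graph

adjacentℕ : ℕ → ℕ → Bool
adjacentℕ i j = (ℕ.∣ i - j ∣ ≡ᵇ 1) ∨ (ℕ.∣ i - j ∣ ≡ᵇ 2)

strip-symmetric : ∀ n → Symmetric (strip n)
strip-symmetric n v w = cong (λ d → (d ≡ᵇ 1) ∨ (d ≡ᵇ 2)) (ℕP.∣-∣-comm (toℕ v) (toℕ w))

∣∸-∸∣≡∣-∣ : ∀ n x y → x ≤ n → y ≤ n → ℕ.∣ (n ∸ x) - (n ∸ y) ∣ ≡ ℕ.∣ x - y ∣
∣∸-∸∣≡∣-∣ n       zero    zero    _         _         = ℕP.∣n-n∣≡0 n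
∣∸-∸∣≡∣-∣ n       zero    (suc y) _         y<n       =
  trans (ℕP.m≤n⇒∣n-m∣≡n∸m (ℕP.m∸n≤m n (suc y))) (ℕP.m∸[m∸n]≡n y<n)
∣∸-∸∣≡∣-∣ n       (suc x) zero    x<n       _         =
  trans (ℕP.∣-∣-comm (n ∸ suc x) n) (∣∸-∸∣≡∣-∣ n zero (suc x) z≤n x<n)
∣∸-∸∣≡∣-∣ (suc n) (suc x) (suc y) (s≤s x≤n) (s≤s y≤n) = ∣∸-∸∣≡∣-∣ n x y x≤n y≤n

strip-opposite : ∀ n (v w : Fin (suc n)) → adj (strip n) (opposite v) (opposite w) ≡ adj (strip n) v w
strip-opposite n v w = cong (λ d → (d ≡ᵇ 1) ∨ (d ≡ᵇ 2)) (begin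
  ℕ.∣ toℕ (opposite v) - toℕ (opposite w) ∣
    ≡⟨ cong₂ ℕ.∣_-_∣ (FinP.opposite-prop v) (FinP.opposite-prop w) ⟩
  ℕ.∣ (n ∸ toℕ v) - (n ∸ toℕ w) ∣
    ≡⟨ ∣∸-∸∣≡∣-∣ n _ _ (FinP.toℕ≤pred[n] v) (FinP.toℕ≤pred[n] w) ⟩
  ℕ.∣ toℕ v - toℕ w ∣ ∎)
  where open ≡-Reasoning

laplacian-opposite : ∀ n (f : Fin (suc n) → ℤ) v →
                     laplacian (strip n) (f ∘ opposite) v ≡ laplacian (strip n) f (opposite v)
laplacian-opposite n f v = trans
  (sumFin-cong λ w → cong (λ b → indicator b (f (opposite v) -ᶻ f (opposite w))) (sym (strip-opposite n v w)))
  (sumFin-opposite (λ u → indicator (adj (strip n) (opposite v) u) (f (opposite v) -ᶻ f u)))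

point-opposite : ∀ {k} (q v : Fin k) → point (opposite q) (opposite v) ≡ point q v
point-opposite q v = cong (λ b → indicator b (+ 1)) (same-decision (v Fin.≟ q))
  where
  same-decision : Dec (v ≡ q) → does (opposite v Fin.≟ opposite q) ≡ does (v Fin.≟ q)
  same-decision (yes refl) = trans (dec-true (opposite v Fin.≟ opposite v) refl)
                                   (sym (dec-true (v Fin.≟ v) refl))
  same-decision (no  v≢q)  = trans (dec-false (opposite v Fin.≟ opposite q) (v≢q ∘ opposite-injective))
                                   (sym (dec-false (v Fin.≟ q) v≢q))
    where
    opposite-injective : opposite v ≡ opposite q → v ≡ q
    opposite-injective eq = trans (sym (FinP.opposite-involutive v))
                                  (trans (cong opposite eq) (FinP.opposite-involutive q))

extend : ∀ {A : Set} {k} → A → (Fin k → A) → ℕ → A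
extend {k = zero}  d f _       = d
extend {k = suc k} d f zero    = f zero
extend {k = suc k} d f (suc i) = extend d (f ∘ suc) i

extend-toℕ : ∀ {A : Set} {k} (d : A) (f : Fin k → A) v → extend d f (toℕ v) ≡ f v
extend-toℕ d f zero    = refl
extend-toℕ d f (suc v) = extend-toℕ d (f ∘ suc) v

extend-fromℕ< : ∀ {A : Set} {k} (d : A) (f : Fin k → A) {j} (j<k : j < k) →
                extend d f j ≡ f (Fin.fromℕ< j<k)
extend-fromℕ< d f j<k = subst (λ i → extend d f i ≡ f (Fin.fromℕ< j<k))
                              (FinP.toℕ-fromℕ< j<k) (extend-toℕ d f (Fin.fromℕ< j<k))

chips : ∀ {k} → (Fin k → ℤ) → ℕ → ℕ
chips D = ℤ.∣_∣ ∘ extend (+ 0) D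

chips-toℕ : ∀ {k} {D : Fin k → ℤ} → (∀ v → + 0 ≤ᶻ D v) → ∀ v → + chips D (toℕ v) ≡ D v
chips-toℕ {D = D} D≥0 v =
  trans (cong (+_ ∘ ℤ.∣_∣) (extend-toℕ (+ 0) D v)) (ℤP.0≤i⇒+∣i∣≡i (D≥0 v))

chips-opposite : ∀ {n} (D : Fin (suc n) → ℤ) {j} → j ≤ n → chips (D ∘ opposite) j ≡ chips D (n ∸ j)
chips-opposite {n} D {j} j≤n = cong ℤ.∣_∣ (begin
  extend (+ 0) (D ∘ opposite) j            ≡⟨ extend-fromℕ< (+ 0) (D ∘ opposite) (s≤s j≤n) ⟩
  D (opposite (Fin.fromℕ< (s≤s j≤n)))       ≡⟨ cong D (FinP.toℕ-injective toℕ-eq) ⟩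
  D (Fin.fromℕ< (s≤s (ℕP.m∸n≤m n j)))       ≡⟨ extend-fromℕ< (+ 0) D (s≤s (ℕP.m∸n≤m n j)) ⟨
  extend (+ 0) D (n ∸ j)                   ∎)
  where
  open ≡-Reasoning
  toℕ-eq : toℕ (opposite (Fin.fromℕ< (s≤s j≤n))) ≡ toℕ (Fin.fromℕ< (s≤s (ℕP.m∸n≤m n j)))
  toℕ-eq = begin
    toℕ (opposite (Fin.fromℕ< (s≤s j≤n)))  ≡⟨ FinP.opposite-prop (Fin.fromℕ< (s≤s j≤n)) ⟩
    n ∸ toℕ (Fin.fromℕ< (s≤s j≤n))         ≡⟨ cong (n ∸_) (FinP.toℕ-fromℕ< (s≤s j≤n)) ⟩
    n ∸ j                                   ≡⟨ FinP.toℕ-fromℕ< (s≤s (ℕP.m∸n≤m n j)) ⟨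
    toℕ (Fin.fromℕ< (s≤s (ℕP.m∸n≤m n j)))  ∎

mirrored : ∀ {n} (D : Fin (suc n) → ℤ) {b j} → j ≤ n →
           b ≤ chips D (n ∸ j) → b ≤ chips (D ∘ opposite) j
mirrored D j≤n = subst (_ ≤_) (sym (chips-opposite D j≤n))

neighbourSum : {A : Set} → (A → A → A) → (ℕ → A) → ℕ → A
neighbourSum _∙_ f zero          = f 1 ∙ f 2
neighbourSum _∙_ f (suc zero)    = f 0 ∙ (f 2 ∙ f 3)
neighbourSum _∙_ f (suc (suc i)) = f i ∙ (f (1 + i) ∙ (f (3 + i) ∙ f (4 + i)))

neighbourSum-cong : ∀ {A : Set} (_∙_ : A → A → A) {f g : ℕ → A} → f ≗ g → ∀ i →
                    neighbourSum _∙_ f i ≡ neighbourSum _∙_ g i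
neighbourSum-cong _∙_ f≗g zero          = cong₂ _∙_ (f≗g 1) (f≗g 2)
neighbourSum-cong _∙_ f≗g (suc zero)    = cong₂ _∙_ (f≗g 0) (cong₂ _∙_ (f≗g 2) (f≗g 3))
neighbourSum-cong _∙_ f≗g (suc (suc i)) =
  cong₂ _∙_ (f≗g i) (cong₂ _∙_ (f≗g (1 + i)) (cong₂ _∙_ (f≗g (3 + i)) (f≗g (4 + i))))

neighbourSum-+ : ∀ (f : ℕ → ℕ) i → neighbourSum _+ᶻ_ (+_ ∘ f) i ≡ + neighbourSum _+_ f i
neighbourSum-+ f zero          = refl
neighbourSum-+ f (suc zero)    = refl
neighbourSum-+ f (suc (suc i)) = refl

restrict : ℕ → (ℕ → ℤ) → ℕ → ℤ
restrict N H j = indicator (j <ᵇ N) (H j)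

sumFin-adjacentℕ : ∀ N i (H : ℕ → ℤ) →
  sumFin {N} (λ w → indicator (adjacentℕ i (toℕ w)) (H (toℕ w))) ≡ neighbourSum _+ᶻ_ (restrict N H) i
sumFin-adjacentℕ zero                zero                H = refl
sumFin-adjacentℕ (suc zero)          zero                H = refl
sumFin-adjacentℕ (suc (suc zero))    zero                H = ℤP.+-identityˡ _
sumFin-adjacentℕ (suc (suc (suc N))) zero                H = begin
  + 0 +ᶻ (H 1 +ᶻ (H 2 +ᶻ sumFin {N} (λ _ → + 0)))  ≡⟨ ℤP.+-identityˡ _ ⟩
  H 1 +ᶻ (H 2 +ᶻ sumFin {N} (λ _ → + 0))
    ≡⟨ cong (λ s → H 1 +ᶻ (H 2 +ᶻ s)) (sumFin-zero N) ⟩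
  H 1 +ᶻ (H 2 +ᶻ + 0)                              ≡⟨ cong (H 1 +ᶻ_) (ℤP.+-identityʳ (H 2)) ⟩
  H 1 +ᶻ H 2                                       ∎
  where open ≡-Reasoning
sumFin-adjacentℕ zero    (suc zero)          H = refl
sumFin-adjacentℕ zero    (suc (suc i))       H = refl
sumFin-adjacentℕ (suc N) (suc zero)          H = cong (H 0 +ᶻ_) (sumFin-adjacentℕ N 0 (H ∘ suc))
sumFin-adjacentℕ (suc N) (suc (suc zero))    H = cong (H 0 +ᶻ_) (sumFin-adjacentℕ N 1 (H ∘ suc))
sumFin-adjacentℕ (suc N) (suc (suc (suc i))) H =
  trans (ℤP.+-identityˡ _) (sumFin-adjacentℕ N (suc (suc i)) (H ∘ suc))

laplacian-strip : ∀ n (g : ℕ → ℤ) v → laplacian (strip n) (g ∘ toℕ) v ≡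
                  neighbourSum _+ᶻ_ (restrict (suc n) (λ j → g (toℕ v) -ᶻ g j)) (toℕ v)
laplacian-strip n g v = sumFin-adjacentℕ (suc n) (toℕ v) (λ j → g (toℕ v) -ᶻ g j)

outside : ℕ → (ℕ → Bool) → ℕ → ℕ
outside n a j = if (j <ᵇ suc n) ∧ not (a j) then 1 else 0

outdegree : ℕ → (ℕ → Bool) → ℕ → ℕ
outdegree n a = neighbourSum _+_ (outside n a)

χℕ : (ℕ → Bool) → ℕ → ℤ
χℕ a j = indicator (a j) (+ 1)

restrict-outside : ∀ n a j → restrict (suc n) (λ j → + 1 -ᶻ χℕ a j) j ≡ + outside n a j
restrict-outside n a j with j <ᵇ suc n | a j
... | false | _     = refl
... | true  | true  = refl
... | true  | false = refl

legalFiring⇒outdegree≤chips : ∀ n {D} {A} → Effective {strip n} D → LegalFiring (strip n) D A →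
  ∀ i → i ≤ n → extend false A i ≡ true → outdegree n (extend false A) i ≤ chips D i
legalFiring⇒outdegree≤chips n {D} {A} D≥0 legal i i≤n i∈A
  with v ← Fin.fromℕ< (s≤s i≤n) | refl ← FinP.toℕ-fromℕ< (s≤s i≤n) =
  ℤP.drop‿+≤+ (ℤP.0≤i-j⇒j≤i
    (subst (+ 0 ≤ᶻ_) (cong₂ _-ᶻ_ (sym (chips-toℕ D≥0 v)) L≡outdegree) (legal v)))
  where
  open ≡-Reasoning
  a : ℕ → Bool
  a = extend false A
  χA≗χa : ∀ w → χ A w ≡ χℕ a (toℕ w)
  χA≗χa w = cong (λ b → indicator b (+ 1)) (sym (extend-toℕ false A w))
  L≡outdegree : laplacian (strip n) (χ A) v ≡ + outdegree n a (toℕ v)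
  L≡outdegree = begin
    laplacian (strip n) (χ A) v
      ≡⟨ sumFin-cong (λ w → cong₂ (λ x y → indicator (adj (strip n) v w) (x -ᶻ y))
                                   (χA≗χa v) (χA≗χa w)) ⟩
    laplacian (strip n) (χℕ a ∘ toℕ) v
      ≡⟨ laplacian-strip n (χℕ a) v ⟩
    neighbourSum _+ᶻ_ (restrict (suc n) (λ j → χℕ a (toℕ v) -ᶻ χℕ a j)) (toℕ v)
      ≡⟨ neighbourSum-cong _+ᶻ_ (λ j → trans (cong (λ x → restrict (suc n) (λ k → x -ᶻ χℕ a k) j)
                                                     (cong (λ b → indicator b (+ 1)) i∈A))
                                               (restrict-outside n a j)) (toℕ v) ⟩
    neighbourSum _+ᶻ_ (+_ ∘ outside n a) (toℕ v)
      ≡⟨ neighbourSum-+ (outside n a) (toℕ v) ⟩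
    + outdegree n a (toℕ v) ∎

-- Counting chips

sumFin-ofℕ : ∀ {k} (f : Fin k → ℕ) → sumFin (+_ ∘ f) ≡ + ℕΣ.sum f
sumFin-ofℕ {zero}  f = refl
sumFin-ofℕ {suc k} f = cong (+ f zero +ᶻ_) (sumFin-ofℕ (f ∘ suc))

chipTotal : ∀ {k} → (Fin k → ℤ) → ℕ
chipTotal {k} D = ℕΣ.sum {k} (chips D ∘ toℕ)

deg≡chipTotal : ∀ {k} {D : Fin k → ℤ} → (∀ v → + 0 ≤ᶻ D v) → sumFin D ≡ + chipTotal D
deg≡chipTotal {k} {D} D≥0 = trans (sumFin-cong (sym ∘ chips-toℕ D≥0)) (sumFin-ofℕ {k} (chips D ∘ toℕ))

zeroAt : ℕ → (ℕ → ℕ) → ℕ → ℕ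
zeroAt x e j = if does (j ℕ.≟ x) then 0 else e j

sum-zeroAt : ∀ {k} (e : ℕ → ℕ) {x} → x < k →
             ℕΣ.sum {k} (e ∘ toℕ) ≡ e x + ℕΣ.sum {k} (zeroAt x e ∘ toℕ)
sum-zeroAt e {zero}  (s≤s _)   = refl
sum-zeroAt e {suc x} (s≤s x<k) =
  trans (cong (λ s → e 0 + s) (sum-zeroAt (e ∘ suc) x<k)) (x∙yz≈y∙xz (e 0) (e (suc x)) _)

sum-map-zeroAt : ∀ (e : ℕ → ℕ) {x ys} → All (x ≢_) ys → sum (map (zeroAt x e) ys) ≡ sum (map e ys)
sum-map-zeroAt e []                 = refl
sum-map-zeroAt e {x} {y ∷ _} (x≢y ∷ x∉ys) =
  cong₂ _+_ (cong (λ b → if b then 0 else e y) (dec-false (y ℕ.≟ x) (x≢y ∘ sym)))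
            (sum-map-zeroAt e x∉ys)

chips-on-distinct : ∀ {k} (e : ℕ → ℕ) {xs} → Unique xs → All (_< k) xs →
                    sum (map e xs) ≤ ℕΣ.sum {k} (e ∘ toℕ)
chips-on-distinct e []                    []            = z≤n
chips-on-distinct {k} e {x ∷ xs} (x∉xs ∷ uniq) (x<k ∷ xs<k) = begin
  e x + sum (map e xs)              ≡⟨ cong (λ s → e x + s) (sum-map-zeroAt e x∉xs) ⟨
  e x + sum (map (zeroAt x e) xs)   ≤⟨ ℕP.+-monoʳ-≤ (e x) (chips-on-distinct (zeroAt x e) uniq xs<k) ⟩
  e x + ℕΣ.sum {k} (zeroAt x e ∘ toℕ)   ≡⟨ sum-zeroAt e x<k ⟨
  ℕΣ.sum {k} (e ∘ toℕ)                  ∎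
  where open ℕP.≤-Reasoning

sum-pointwise-≤ : ∀ (e : ℕ → ℕ) {bs xs} → Pointwise (λ b x → b ≤ e x) bs xs →
                  sum bs ≤ sum (map e xs)
sum-pointwise-≤ e []            = z≤n
sum-pointwise-≤ e (b≤ex ∷ bs≤e) = ℕP.+-mono-≤ b≤ex (sum-pointwise-≤ e bs≤e)

distinct : ∀ xs → {True (unique? xs)} → Unique xs
distinct xs {u} = toWitness u

distinct-+ : ∀ t {cs} → Unique cs → Unique (map (_+ t) cs)
distinct-+ t = map⁺ (λ {x} {y} → ℕP.+-cancelʳ-≡ t x y)

module ChipBudget {n} (e : ℕ → ℕ) (total≤3 : ℕΣ.sum {suc n} (e ∘ toℕ) ≤ 3) where

  budget : ∀ {xs bs} → Unique xs → All (_≤ n) xs → Pointwise (λ b x → b ≤ e x) bs xs → sum bs ≤ 3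
  budget uniq xs≤n bs≤e = ℕP.≤-trans (sum-pointwise-≤ e bs≤e)
    (ℕP.≤-trans (chips-on-distinct e uniq (All.map s≤s xs≤n)) total≤3)

  remaining : ∀ x {k} → x + k ≤ 3 → x ≤ 3 ∸ k
  remaining x = ℕP.m+n≤o⇒m≤o∸n x

  overfull : ∀ {xs bs} → Unique xs → All (_≤ n) xs → Pointwise (λ b x → b ≤ e x) bs xs →
             {T (3 <ᵇ sum bs)} → ⊥
  overfull uniq xs≤n bs≤e {3<Σbs} = ℕP.<⇒≱ (ℕP.<ᵇ⇒< 3 _ 3<Σbs) (budget uniq xs≤n bs≤e)

  budget-at : ∀ xs {bs} {uniq : True (unique? xs)} {xs≤n : True (All.all? (ℕP._≤? n) xs)} →
              Pointwise (λ b x → b ≤ e x) bs xs → sum bs ≤ 3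
  budget-at xs {uniq = uniq} {xs≤n} = budget (toWitness uniq) (toWitness xs≤n)

  overfull-at : ∀ xs {bs} {uniq : True (unique? xs)} {xs≤n : True (All.all? (ℕP._≤? n) xs)} →
                Pointwise (λ b x → b ≤ e x) bs xs → {T (3 <ᵇ sum bs)} → ⊥
  overfull-at xs {uniq = uniq} {xs≤n} = overfull (toWitness uniq) (toWitness xs≤n)

-- Legal firings on the strip with at most three chips

prefixConstantOrChange : (a : ℕ → Bool) → ∀ s →
  (∀ j → j ≤ s → a j ≡ a 0) ⊎ ∃[ t ] (t < s × (∀ j → j ≤ t → a j ≡ a 0) × a (suc t) ≢ a 0)
prefixConstantOrChange a zero = inj₁ λ { .zero z≤n → refl }
prefixConstantOrChange a (suc s) with prefixConstantOrChange a s
... | inj₂ (t , t<s , const , change) = inj₂ (t , ℕP.m<n⇒m<1+n t<s , const , change)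
... | inj₁ const with a (suc s) ≟ᵇ a 0
...   | no  change = inj₂ (s , ℕP.≤-refl , const , change)
...   | yes same   = inj₁ λ j j≤1+s → case-last j (ℕP.m≤n⇒m<n∨m≡n j≤1+s)
  where
  case-last : ∀ j → j < suc s ⊎ j ≡ suc s → a j ≡ a 0
  case-last j (inj₁ (s≤s j≤s)) = const j j≤s
  case-last j (inj₂ refl)      = same

flipped : ∀ {x y b : Bool} → x ≢ y → y ≡ b → x ≡ not b
flipped x≢y y≡b = trans (¬-not x≢y) (cong not y≡b)

firstChange : (a : ℕ → Bool) → ∀ s → a s ≢ a 0 →
              ∃[ t ] (t < s × (∀ j → j ≤ t → a j ≡ a 0) × a (suc t) ≢ a 0)
firstChange a s as≢a0 with prefixConstantOrChange a s
... | inj₁ const  = ⊥-elim (as≢a0 (const s ℕP.≤-refl))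
... | inj₂ change = change

vertex : ∀ {m} k → {T (k ≤ᵇ 6)} → k ≤ 6 + m
vertex {m} k {k≤6} = ℕP.≤-trans (ℕP.≤ᵇ⇒≤ k 6 k≤6) (ℕP.m≤m+n 6 m)

-- The chip patterns forced on G_{6+m} by a legal firing of a set A ∌ q when there are at most three
-- chips. Constructors are named after A; prefix t fires {0,…,t+1} and suffix k fires {k,…,6+m}.
data FiringShape (m : ℕ) (e : ℕ → ℕ) (q : ℕ) : Set where
  first             : 2 ≤ e 0 → FiringShape m e q
  prefix            : ∀ t → 3 + t ≤ 6 + m → 1 + t < q → 1 ≤ e t → 2 ≤ e (1 + t) → FiringShape m e q
  allButLast        : q ≡ 6 + m → 1 ≤ e (4 + m) → 1 ≤ e (5 + m) → FiringShape m e q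
  second            : 3 ≤ e 1 → FiringShape m e q
  allButSecond      : q ≡ 1 → 1 ≤ e 0 → 1 ≤ e 2 → 1 ≤ e 3 → FiringShape m e q
  last              : 2 ≤ e (6 + m) → FiringShape m e q
  suffix            : ∀ k → 2 ≤ k → 1 + k ≤ 6 + m → q < k → 2 ≤ e k → 1 ≤ e (1 + k) →
                      FiringShape m e q
  allButFirst       : q ≡ 0 → 1 ≤ e 1 → 1 ≤ e 2 → FiringShape m e q
  penultimate       : 3 ≤ e (5 + m) → FiringShape m e q
  allButPenultimate : q ≡ 5 + m → 1 ≤ e (3 + m) → 1 ≤ e (4 + m) → 1 ≤ e (6 + m) → FiringShape m e q

module FiringShapes (m : ℕ) (a : ℕ → Bool) (e : ℕ → ℕ)
  (total≤3 : ℕΣ.sum {7 + m} (e ∘ toℕ) ≤ 3)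
  (legal : ∀ i → i ≤ 6 + m → a i ≡ true → outdegree (6 + m) a i ≤ e i) where

  open ChipBudget {6 + m} e total≤3

  N : ℕ
  N = 6 + m

  out : ℕ → ℕ
  out = outside N a

  membership : ∀ j → a j ≡ true ⊎ a j ≡ false
  membership j with a j
  ... | true  = inj₁ refl
  ... | false = inj₂ refl

  clash : ∀ {j} → a j ≡ true → a j ≡ false → ⊥
  clash j∈A j∉A with () ← trans (sym j∈A) j∉A

  outside-1 : ∀ {j} → j ≤ N → a j ≡ false → 1 ≤ out j
  outside-1 {j} j≤N j∉A rewrite j∉A with j <ᵇ suc N | ℕP.<⇒<ᵇ (s≤s j≤N)
  ... | true | _ = ℕP.≤-refl

  outside-0⇒inside : ∀ {j} → j ≤ N → out j ≤ 0 → a j ≡ true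
  outside-0⇒inside j≤N out≤0 = ¬-not λ j∉A → ℕP.<⇒≱ (outside-1 j≤N j∉A) out≤0

  chips-at-0 : ∀ {x₁ x₂} → a 0 ≡ true → x₁ ≤ out 1 → x₂ ≤ out 2 → x₁ + x₂ ≤ e 0
  chips-at-0 a0 p₁ p₂ = ℕP.≤-trans (ℕP.+-mono-≤ p₁ p₂) (legal 0 z≤n a0)

  chips-at-1 : ∀ {x₀ x₂ x₃} → a 1 ≡ true → x₀ ≤ out 0 → x₂ ≤ out 2 → x₃ ≤ out 3 →
               x₀ + (x₂ + x₃) ≤ e 1
  chips-at-1 a1 p₀ p₂ p₃ =
    ℕP.≤-trans (ℕP.+-mono-≤ p₀ (ℕP.+-mono-≤ p₂ p₃)) (legal 1 (vertex 1) a1)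

  chips-at-2+ : ∀ {x₁ x₂ x₃ x₄} j → 2 + j ≤ N → a (2 + j) ≡ true →
                x₁ ≤ out j → x₂ ≤ out (1 + j) → x₃ ≤ out (3 + j) → x₄ ≤ out (4 + j) →
                x₁ + (x₂ + (x₃ + x₄)) ≤ e (2 + j)
  chips-at-2+ j 2+j≤N a2+j p₁ p₂ p₃ p₄ =
    ℕP.≤-trans (ℕP.+-mono-≤ p₁ (ℕP.+-mono-≤ p₂ (ℕP.+-mono-≤ p₃ p₄)))
               (legal (2 + j) 2+j≤N a2+j)

  out-1+-2+≤outdegree : ∀ j → out (1 + j) + out (2 + j) ≤ outdegree N a j
  out-1+-2+≤outdegree zero          = ℕP.≤-refl
  out-1+-2+≤outdegree (suc zero)    = ℕP.m≤n+m _ (out 0)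
  out-1+-2+≤outdegree (suc (suc k)) = ℕP.≤-trans (ℕP.m≤n+m _ (out (1 + k))) (ℕP.m≤n+m _ (out k))

  out-1+≤outdegree : ∀ j → out (1 + j) ≤ outdegree N a j
  out-1+≤outdegree j = ℕP.≤-trans (ℕP.m≤m+n _ _) (out-1+-2+≤outdegree j)

  out-2+≤outdegree : ∀ j → out (2 + j) ≤ outdegree N a j
  out-2+≤outdegree j = ℕP.≤-trans (ℕP.m≤n+m _ _) (out-1+-2+≤outdegree j)

  -- A chip-free vertex of A has all its neighbours in A.
  spread : ∀ s → a s ≡ true → (∀ j → s ≤ j → j ≤ N → e j ≡ 0) →
           ∀ j → s ≤ j → j ≤ N → a j ≡ true
  spread s a-s no-chips zero    z≤n   _     = a-s
  spread s a-s no-chips (suc j) s≤1+j 1+j≤N with ℕP.m≤n⇒m<n∨m≡n s≤1+j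
  ... | inj₂ refl      = a-s
  ... | inj₁ (s≤s s≤j) = outside-0⇒inside 1+j≤N (begin
    out (1 + j)        ≤⟨ out-1+≤outdegree j ⟩
    outdegree N a j    ≤⟨ legal j j≤N (spread s a-s no-chips j s≤j j≤N) ⟩
    e j                ≡⟨ no-chips j s≤j j≤N ⟩
    0                  ∎)
    where
    open ℕP.≤-Reasoning
    j≤N : j ≤ N
    j≤N = ℕP.<⇒≤ 1+j≤N

  leaves-at-1 : ∀ q → q ≤ N → a q ≡ false → a 0 ≡ true → a 1 ≡ false → FiringShape m e q
  leaves-at-1 q q≤N q∉A a0 a1 = cases (membership 2) (membership 3) (membership 4)
    where
    out1 : 1 ≤ out 1
    out1 = outside-1 (vertex 1) a1
    e0 : 1 ≤ e 0
    e0 = chips-at-0 a0 out1 z≤n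

    all-but-1 : a 2 ≡ true → a 3 ≡ true → FiringShape m e q
    all-but-1 a2 a3 = allButSecond (forced q q≤N q∉A) e0 e2 e3
      where
      e2 : 1 ≤ e 2
      e2 = chips-at-2+ 0 (vertex 2) a2 z≤n out1 z≤n z≤n
      e3 : 1 ≤ e 3
      e3 = chips-at-2+ 1 (vertex 3) a3 out1 z≤n z≤n z≤n
      e2≤1 : e 2 ≤ 1
      e2≤1 = remaining (e 2) (budget-at (2 ∷ 0 ∷ 3 ∷ []) (ℕP.≤-refl ∷ e0 ∷ e3 ∷ []))
      a4 : a 4 ≡ true
      a4 = outside-0⇒inside (vertex 4)
             (ℕP.≤-pred (ℕP.≤-trans (chips-at-2+ 0 (vertex 2) a2 z≤n out1 z≤n ℕP.≤-refl) e2≤1))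
      no-chips : ∀ j → 4 ≤ j → j ≤ N → e j ≡ 0
      no-chips j 4≤j j≤N = ℕP.n≤0⇒n≡0 (remaining (e j) (budget
        ((ℕP.>⇒≢ (ℕP.<-trans (s≤s z≤n) 4≤j) ∷ ℕP.>⇒≢ (ℕP.<-trans ℕP.≤-refl 4≤j)
            ∷ ℕP.>⇒≢ 4≤j ∷ [])
          ∷ distinct (0 ∷ 2 ∷ 3 ∷ []))
        (j≤N ∷ vertex 0 ∷ vertex 2 ∷ vertex 3 ∷ [])
        (ℕP.≤-refl ∷ e0 ∷ e2 ∷ e3 ∷ [])))
      forced : ∀ q → q ≤ N → a q ≡ false → q ≡ 1
      forced 0 _ 0∉A = ⊥-elim (clash a0 0∉A)
      forced 1 _ _   = refl
      forced 2 _ 2∉A = ⊥-elim (clash a2 2∉A)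
      forced 3 _ 3∉A = ⊥-elim (clash a3 3∉A)
      forced q@(suc (suc (suc (suc _)))) q≤N q∉A =
        ⊥-elim (clash (spread 4 a4 no-chips q (s≤s (s≤s (s≤s (s≤s z≤n)))) q≤N) q∉A)

    cases : a 2 ≡ true ⊎ a 2 ≡ false → a 3 ≡ true ⊎ a 3 ≡ false → a 4 ≡ true ⊎ a 4 ≡ false →
            FiringShape m e q
    cases (inj₂ a2) _         _         = first (chips-at-0 a0 out1 (outside-1 (vertex 2) a2))
    cases (inj₁ a2) (inj₁ a3) _         = all-but-1 a2 a3
    cases (inj₁ a2) (inj₂ a3) (inj₂ a4) = ⊥-elim (overfull-at (0 ∷ 2 ∷ [])
      (e0 ∷ chips-at-2+ 0 (vertex 2) a2 z≤n out1 (outside-1 (vertex 3) a3) (outside-1 (vertex 4) a4) ∷ []))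
    cases (inj₁ a2) (inj₂ a3) (inj₁ a4) = ⊥-elim (overfull-at (0 ∷ 2 ∷ 4 ∷ [])
      (e0 ∷ chips-at-2+ 0 (vertex 2) a2 z≤n out1 (outside-1 (vertex 3) a3) z≤n
          ∷ chips-at-2+ 2 (vertex 4) a4 z≤n (outside-1 (vertex 3) a3) z≤n z≤n ∷ []))

  leaves-at-2+ : ∀ q → q ≤ N → a q ≡ false →
                 ∀ t → 1 + t < q → (∀ j → j ≤ 1 + t → a j ≡ true) → a (2 + t) ≡ false →
                 FiringShape m e q
  leaves-at-2+ q q≤N q∉A t 2+t≤q prefix-in a2+t = cases (ℕP.m≤n⇒m<n∨m≡n 2+t≤N)
    where
    2+t≤N : 2 + t ≤ N
    2+t≤N = ℕP.≤-trans 2+t≤q q≤N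
    1+t≤N : 1 + t ≤ N
    1+t≤N = ℕP.m+n≤o⇒n≤o 1 2+t≤N
    t≤N : t ≤ N
    t≤N = ℕP.m+n≤o⇒n≤o 2 2+t≤N
    out2+t : 1 ≤ out (2 + t)
    out2+t = outside-1 2+t≤N a2+t
    a1+t : a (1 + t) ≡ true
    a1+t = prefix-in (1 + t) ℕP.≤-refl
    et : 1 ≤ e t
    et = ℕP.≤-trans (ℕP.≤-trans out2+t (out-2+≤outdegree t)) (legal t t≤N (prefix-in t (ℕP.n≤1+n t)))
    e1+t : 1 ≤ e (1 + t)
    e1+t = ℕP.≤-trans (ℕP.≤-trans out2+t (out-1+≤outdegree (1 + t))) (legal (1 + t) 1+t≤N a1+t)

    all-but-penultimate : 3 + t ≡ N → a (3 + t) ≡ true → FiringShape m e q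
    all-but-penultimate 3+t≡N a3+t = allButPenultimate
      (trans q≡2+t (cong (λ i → 2 + i) t≡3+m))
      (subst (λ i → 1 ≤ e i) t≡3+m et)
      (subst (λ i → 1 ≤ e (1 + i)) t≡3+m e1+t)
      (subst (λ i → 1 ≤ e i) 3+t≡N
             (chips-at-2+ (1 + t) (ℕP.≤-reflexive 3+t≡N) a3+t z≤n out2+t z≤n z≤n))
      where
      t≡3+m : t ≡ 3 + m
      t≡3+m = ℕP.+-cancelˡ-≡ 3 t (3 + m) 3+t≡N
      q≡2+t : q ≡ 2 + t
      q≡2+t with ℕP.m≤n⇒m<n∨m≡n 2+t≤q
      ... | inj₂ 2+t≡q = sym 2+t≡q
      ... | inj₁ 3+t≤q = ⊥-elim (clash (subst (λ j → a j ≡ true) 3+t≡q a3+t) q∉A)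
        where
        3+t≡q : 3 + t ≡ q
        3+t≡q = ℕP.≤-antisym 3+t≤q (subst (q ≤_) (sym 3+t≡N) q≤N)

    crowded : a (3 + t) ≡ true → 4 + t ≤ N → ⊥
    crowded a3+t 4+t≤N = overfull (distinct-+ t (distinct (0 ∷ 1 ∷ 3 ∷ 4 ∷ [])))
      (t≤N ∷ 1+t≤N ∷ 3+t≤N ∷ 4+t≤N ∷ []) (et ∷ e1+t ∷ e3+t ∷ e4+t ∷ [])
      where
      3+t≤N : 3 + t ≤ N
      3+t≤N = ℕP.<⇒≤ 4+t≤N
      e3+t : 1 ≤ e (3 + t)
      e3+t = chips-at-2+ (1 + t) 3+t≤N a3+t z≤n out2+t z≤n z≤n
      e3+t≤1 : e (3 + t) ≤ 1
      e3+t≤1 = remaining (e (3 + t)) (budget (distinct-+ t (distinct (3 ∷ 0 ∷ 1 ∷ [])))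
        (3+t≤N ∷ t≤N ∷ 1+t≤N ∷ []) (ℕP.≤-refl ∷ et ∷ e1+t ∷ []))
      a4+t : a (4 + t) ≡ true
      a4+t = outside-0⇒inside 4+t≤N (ℕP.m+n≤o⇒m≤o _ (ℕP.≤-pred
        (ℕP.≤-trans (chips-at-2+ (1 + t) 3+t≤N a3+t z≤n out2+t ℕP.≤-refl z≤n) e3+t≤1)))
      e4+t : 1 ≤ e (4 + t)
      e4+t = chips-at-2+ (2 + t) 4+t≤N a4+t out2+t z≤n z≤n z≤n

    cases : 2 + t < N ⊎ 2 + t ≡ N → FiringShape m e q
    cases (inj₂ 2+t≡N) = allButLast
      (ℕP.≤-antisym q≤N (subst (_≤ q) 2+t≡N 2+t≤q))
      (subst (λ i → 1 ≤ e i) t≡4+m et)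
      (subst (λ i → 1 ≤ e (1 + i)) t≡4+m e1+t)
      where
      t≡4+m : t ≡ 4 + m
      t≡4+m = ℕP.+-cancelˡ-≡ 2 t (4 + m) 2+t≡N
    cases (inj₁ 3+t≤N) with membership (3 + t)
    ... | inj₂ a3+t = prefix t 3+t≤N 2+t≤q et (begin
      2                              ≤⟨ ℕP.+-mono-≤ out2+t (outside-1 3+t≤N a3+t) ⟩
      out (2 + t) + out (3 + t)      ≤⟨ out-1+-2+≤outdegree (1 + t) ⟩
      outdegree N a (1 + t)          ≤⟨ legal (1 + t) 1+t≤N a1+t ⟩
      e (1 + t)                      ∎)
      where open ℕP.≤-Reasoning
    ... | inj₁ a3+t with ℕP.m≤n⇒m<n∨m≡n 3+t≤N
    ...   | inj₂ 3+t≡N = all-but-penultimate 3+t≡N a3+t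
    ...   | inj₁ 4+t≤N = ⊥-elim (crowded a3+t 4+t≤N)

  enters-at-1 : ∀ q → q ≤ N → a q ≡ false → a 0 ≡ false → a 1 ≡ true → FiringShape m e q
  enters-at-1 q q≤N q∉A a0 a1 = cases (membership 2) (membership 3)
    where
    out0 : 1 ≤ out 0
    out0 = outside-1 z≤n a0
    e1 : 1 ≤ e 1
    e1 = chips-at-1 a1 out0 z≤n z≤n

    all-but-0 : a 2 ≡ true → FiringShape m e q
    all-but-0 a2 = allButFirst (forced q q≤N q∉A) e1 e2
      where
      e2 : 1 ≤ e 2
      e2 = chips-at-2+ 0 (vertex 2) a2 out0 z≤n z≤n z≤n
      inside-next : ∀ k → 1 + k ≤ N → (∀ j → 1 ≤ j → j ≤ k → a j ≡ true) → a (1 + k) ≡ true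
      inside-next zero                _   _ = a1
      inside-next (suc zero)          _   _ = a2
      inside-next (suc (suc zero)) 3≤N _ = ¬-not λ a3 → overfull-at (1 ∷ 2 ∷ [])
        (chips-at-1 a1 out0 z≤n (outside-1 3≤N a3)
          ∷ chips-at-2+ 0 (vertex 2) a2 out0 z≤n (outside-1 3≤N a3) z≤n ∷ [])
      inside-next (suc (suc (suc zero))) 4≤N inside = ¬-not λ a4 → overfull-at (1 ∷ 2 ∷ 3 ∷ [])
        (e1 ∷ chips-at-2+ 0 (vertex 2) a2 out0 z≤n z≤n (outside-1 4≤N a4)
          ∷ chips-at-2+ 1 (vertex 3) (inside 3 (s≤s z≤n) ℕP.≤-refl) z≤n z≤n (outside-1 4≤N a4) z≤n ∷ [])
      inside-next (suc (suc (suc (suc k)))) 5+k≤N inside = ¬-not λ a5+k → overfull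
        (((λ ()) ∷ (λ ()) ∷ (λ ()) ∷ []) ∷ ((λ ()) ∷ (λ ()) ∷ [])
          ∷ (ℕP.<⇒≢ ℕP.≤-refl ∷ []) ∷ [] ∷ [])
        (vertex 1 ∷ vertex 2 ∷ 3+k≤N ∷ 4+k≤N ∷ [])
        (e1 ∷ e2
          ∷ chips-at-2+ (1 + k) 3+k≤N (inside (3 + k) (s≤s z≤n) (ℕP.n≤1+n _))
                        z≤n z≤n z≤n (outside-1 5+k≤N a5+k)
          ∷ chips-at-2+ (2 + k) 4+k≤N (inside (4 + k) (s≤s z≤n) ℕP.≤-refl)
                        z≤n z≤n (outside-1 5+k≤N a5+k) z≤n
          ∷ [])
        where
        4+k≤N : 4 + k ≤ N
        4+k≤N = ℕP.<⇒≤ 5+k≤N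
        3+k≤N : 3 + k ≤ N
        3+k≤N = ℕP.<⇒≤ 4+k≤N
      inside-upto : ∀ k → k ≤ N → ∀ j → 1 ≤ j → j ≤ k → a j ≡ true
      inside-upto zero    _     j 1≤j j≤0   = ⊥-elim (ℕP.<⇒≱ 1≤j j≤0)
      inside-upto (suc k) 1+k≤N j 1≤j j≤1+k with ℕP.m≤n⇒m<n∨m≡n j≤1+k
      ... | inj₁ (s≤s j≤k) = inside-upto k (ℕP.<⇒≤ 1+k≤N) j 1≤j j≤k
      ... | inj₂ refl      = inside-next k 1+k≤N (inside-upto k (ℕP.<⇒≤ 1+k≤N))
      forced : ∀ q → q ≤ N → a q ≡ false → q ≡ 0
      forced zero    _   _   = refl
      forced (suc q) q≤N q∉A =
        ⊥-elim (clash (inside-upto (suc q) q≤N (suc q) (s≤s z≤n) ℕP.≤-refl) q∉A)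

    cases : a 2 ≡ true ⊎ a 2 ≡ false → a 3 ≡ true ⊎ a 3 ≡ false → FiringShape m e q
    cases (inj₁ a2) _         = all-but-0 a2
    cases (inj₂ a2) (inj₂ a3) = second (chips-at-1 a1 out0 (outside-1 (vertex 2) a2) (outside-1 (vertex 3) a3))
    cases (inj₂ a2) (inj₁ a3) = ⊥-elim (overfull-at (1 ∷ 3 ∷ 4 ∷ []) (e1≥2 ∷ e3 ∷ e4 ∷ []))
      where
      out2 : 1 ≤ out 2
      out2 = outside-1 (vertex 2) a2
      e1≥2 : 2 ≤ e 1
      e1≥2 = chips-at-1 a1 out0 out2 z≤n
      e3 : 1 ≤ e 3
      e3 = chips-at-2+ 1 (vertex 3) a3 z≤n out2 z≤n z≤n
      e3≤1 : e 3 ≤ 1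
      e3≤1 = remaining (e 3) (budget-at (3 ∷ 1 ∷ []) (ℕP.≤-refl ∷ e1≥2 ∷ []))
      a4 : a 4 ≡ true
      a4 = outside-0⇒inside (vertex 4) (ℕP.m+n≤o⇒m≤o _ (ℕP.≤-pred
        (ℕP.≤-trans (chips-at-2+ 1 (vertex 3) a3 z≤n out2 ℕP.≤-refl z≤n) e3≤1)))
      e4 : 1 ≤ e 4
      e4 = chips-at-2+ 2 (vertex 4) a4 out2 z≤n z≤n z≤n

  enters-at-2+ : ∀ q → q ≤ N → a q ≡ false →
                 ∀ t → 2 + t ≤ N → (∀ j → j ≤ 1 + t → a j ≡ false) → a (2 + t) ≡ true →
                 FiringShape m e q
  enters-at-2+ q q≤N q∉A t 2+t≤N prefix-out a2+t = cases (ℕP.m≤n⇒m<n∨m≡n 2+t≤N)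
    where
    1+t≤N : 1 + t ≤ N
    1+t≤N = ℕP.m+n≤o⇒n≤o 1 2+t≤N
    out-t : 1 ≤ out t
    out-t = outside-1 (ℕP.m+n≤o⇒n≤o 2 2+t≤N) (prefix-out t (ℕP.n≤1+n t))
    out1+t : 1 ≤ out (1 + t)
    out1+t = outside-1 1+t≤N (prefix-out (1 + t) ℕP.≤-refl)
    e2+t : 2 ≤ e (2 + t)
    e2+t = chips-at-2+ t 2+t≤N a2+t out-t out1+t z≤n z≤n

    suffix-from-2+t : 3 + t ≤ N → a (3 + t) ≡ true → FiringShape m e q
    suffix-from-2+t 3+t≤N a3+t = suffix (2 + t) (s≤s (s≤s z≤n)) 3+t≤N q<2+t e2+t e3+t
      where
      e3+t : 1 ≤ e (3 + t)
      e3+t = chips-at-2+ (1 + t) 3+t≤N a3+t out1+t z≤n z≤n z≤n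
      e2+t≤2 : e (2 + t) ≤ 2
      e2+t≤2 = remaining (e (2 + t)) (budget (distinct-+ t (distinct (2 ∷ 3 ∷ [])))
                                             (2+t≤N ∷ 3+t≤N ∷ []) (ℕP.≤-refl ∷ e3+t ∷ []))
      no-chips : ∀ j → 4 + t ≤ j → j ≤ N → e j ≡ 0
      no-chips j 4+t≤j j≤N = ℕP.n≤0⇒n≡0 (remaining (e j) (budget
        ((ℕP.>⇒≢ (ℕP.<-trans (ℕP.n<1+n (2 + t)) 4+t≤j) ∷ ℕP.>⇒≢ 4+t≤j ∷ [])
          ∷ distinct-+ t (distinct (2 ∷ 3 ∷ [])))
        (j≤N ∷ 2+t≤N ∷ 3+t≤N ∷ [])
        (ℕP.≤-refl ∷ e2+t ∷ e3+t ∷ [])))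
      inside : ∀ j → 2 + t ≤ j → j ≤ N → a j ≡ true
      inside j 2+t≤j j≤N with ℕP.m≤n⇒m<n∨m≡n 2+t≤j
      ... | inj₂ refl = a2+t
      ... | inj₁ 3+t≤j with ℕP.m≤n⇒m<n∨m≡n 3+t≤j
      ...   | inj₂ refl   = a3+t
      ...   | inj₁ 4+t≤j = spread (4 + t) a4+t no-chips j 4+t≤j j≤N
        where
        4+t≤N : 4 + t ≤ N
        4+t≤N = ℕP.≤-trans 4+t≤j j≤N
        a4+t : a (4 + t) ≡ true
        a4+t = outside-0⇒inside 4+t≤N (ℕP.≤-pred (ℕP.≤-pred
          (ℕP.≤-trans (chips-at-2+ t 2+t≤N a2+t out-t out1+t z≤n ℕP.≤-refl) e2+t≤2)))
      q<2+t : q < 2 + t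
      q<2+t = ℕP.≰⇒> λ 2+t≤q → clash (inside q 2+t≤q q≤N) q∉A

    cases : 2 + t < N ⊎ 2 + t ≡ N → FiringShape m e q
    cases (inj₂ 2+t≡N) = last (subst (λ i → 2 ≤ e i) 2+t≡N e2+t)
    cases (inj₁ 3+t≤N) with membership (3 + t)
    ... | inj₁ a3+t = suffix-from-2+t 3+t≤N a3+t
    ... | inj₂ a3+t with ℕP.m≤n⇒m<n∨m≡n 3+t≤N
    ...   | inj₂ 3+t≡N = penultimate (subst (λ i → 3 ≤ e i) (ℕP.suc-injective 3+t≡N) e2+t≥3)
      where
      e2+t≥3 : 3 ≤ e (2 + t)
      e2+t≥3 = chips-at-2+ t 2+t≤N a2+t out-t out1+t (outside-1 3+t≤N a3+t) z≤n
    ...   | inj₁ 4+t≤N with membership (4 + t)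
    ...     | inj₂ a4+t = ⊥-elim (overfull (distinct (2 + t ∷ [])) (2+t≤N ∷ [])
      (chips-at-2+ t 2+t≤N a2+t out-t out1+t (outside-1 3+t≤N a3+t) (outside-1 4+t≤N a4+t) ∷ []))
    ...     | inj₁ a4+t = ⊥-elim (overfull (distinct-+ t (distinct (2 ∷ 4 ∷ []))) (2+t≤N ∷ 4+t≤N ∷ [])
      (chips-at-2+ t 2+t≤N a2+t out-t out1+t (outside-1 3+t≤N a3+t) z≤n
        ∷ chips-at-2+ (2 + t) 4+t≤N a4+t z≤n (outside-1 3+t≤N a3+t) z≤n z≤n ∷ []))

  firingShape : ∀ q → q ≤ N → a q ≡ false → ∀ v → v ≤ N → a v ≡ true → FiringShape m e q
  firingShape q q≤N q∉A v v≤N v∈A with membership 0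
  ... | inj₁ a0 with firstChange a q (λ aq≡a0 → clash a0 (trans (sym aq≡a0) q∉A))
  ...   | zero  , _   , _     , change = leaves-at-1 q q≤N q∉A a0 (flipped change a0)
  ...   | suc t , t<q , const , change =
          leaves-at-2+ q q≤N q∉A t t<q (λ j j≤1+t → trans (const j j≤1+t) a0) (flipped change a0)
  firingShape q q≤N q∉A v v≤N v∈A | inj₂ a0
    with firstChange a v (λ av≡a0 → clash v∈A (trans av≡a0 a0))
  ...   | zero  , _   , _     , change = enters-at-1 q q≤N q∉A a0 (flipped change a0)
  ...   | suc t , t<v , const , change =
          enters-at-2+ q q≤N q∉A t (ℕP.≤-trans t<v v≤N) (λ j j≤1+t → trans (const j j≤1+t) a0)
                       (flipped change a0)

-- Excluding a divisor of rank one and degree at most three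

record RankOneDegree≤3 (n : ℕ) (D : Divisor (strip n)) : Set where
  field
    effective : Effective {strip n} D
    deg≤3     : deg {strip n} D ≤ᶻ + 3
    reaches   : ReachesEveryVertex {strip n} D

module _ {n} {D : Divisor (strip n)} (R : RankOneDegree≤3 n D) where
  open RankOneDegree≤3 R

  chipTotal≤3 : chipTotal D ≤ 3
  chipTotal≤3 = ℤP.drop‿+≤+ (subst (_≤ᶻ + 3) (deg≡chipTotal effective) deg≤3)

  fire : (f : Fin (suc n) → ℤ) → Effective {strip n} (λ v → D v -ᶻ laplacian (strip n) f v) →
         RankOneDegree≤3 n (λ v → D v -ᶻ laplacian (strip n) f v)
  fire f D'≥0 = record
    { effective = D'≥0
    ; deg≤3     = subst (_≤ᶻ + 3) (∼⇒deg≡ (strip n) (strip-symmetric n) {D} {D'} D∼D') deg≤3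
    ; reaches   = reachesEveryVertex-resp-∼ (strip n) {D} {D'} D∼D' reaches
    }
    where
    D' : Divisor (strip n)
    D' v = D v -ᶻ laplacian (strip n) f v
    D∼D' : _∼_ {strip n} D D'
    D∼D' = ∼-minus-laplacian (strip n) D f

  reflect : RankOneDegree≤3 n (D ∘ opposite)
  reflect = record
    { effective = effective ∘ opposite
    ; deg≤3     = subst (_≤ᶻ + 3) (sym (sumFin-opposite D)) deg≤3
    ; reaches   = reaches-reflected
    }
    where
    reaches-reflected : ReachesEveryVertex {strip n} (D ∘ opposite)
    reaches-reflected q with reaches (opposite q)
    ... | E , E≥0 , h , D-q-E≡Lh = E ∘ opposite , E≥0 ∘ opposite , h ∘ opposite , λ v → begin
      (D (opposite v) -ᶻ point q v) -ᶻ E (opposite v)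
        ≡⟨ cong (λ p → (D (opposite v) -ᶻ p) -ᶻ E (opposite v)) (point-opposite q v) ⟨
      (D (opposite v) -ᶻ point (opposite q) (opposite v)) -ᶻ E (opposite v)
        ≡⟨ D-q-E≡Lh (opposite v) ⟩
      laplacian (strip n) h (opposite v)
        ≡⟨ laplacian-opposite n h v ⟨
      laplacian (strip n) (h ∘ opposite) v ∎
      where open ≡-Reasoning

module Configuration (m : ℕ) {D : Divisor (strip (6 + m))} (R : RankOneDegree≤3 (6 + m) D) where
  open RankOneDegree≤3 R

  N : ℕ
  N = 6 + m

  e : ℕ → ℕ
  e = chips D

  open ChipBudget {N} e (chipTotal≤3 R) public

  shape : ∀ q → q ≤ N → e q ≡ 0 → FiringShape m e q
  shape q q≤N eq≡0 = from-firing (legalFiring-avoiding (strip N) effective q′ Dq′≡0 (reaches q′))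
    where
    q′ : Fin (suc N)
    q′ = Fin.fromℕ< (s≤s q≤N)
    toℕq′≡q : toℕ q′ ≡ q
    toℕq′≡q = FinP.toℕ-fromℕ< (s≤s q≤N)
    Dq′≡0 : D q′ ≡ + 0
    Dq′≡0 = trans (sym (chips-toℕ effective q′)) (cong +_ (trans (cong e toℕq′≡q) eq≡0))
    from-firing : ∃[ A ] (A q′ ≡ false × (∃[ v ] A v ≡ true) × LegalFiring (strip N) D A) →
                  FiringShape m e q
    from-firing (A , q′∉A , (v , v∈A) , legal) =
      FiringShapes.firingShape m (extend false A) e (chipTotal≤3 R)
        (legalFiring⇒outdegree≤chips N effective legal)
        q q≤N (subst (λ i → extend false A i ≡ false) toℕq′≡q
                     (trans (extend-toℕ false A q′) q′∉A))
        (toℕ v) (FinP.toℕ≤pred[n] v) (trans (extend-toℕ false A v) v∈A)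

  module ThreeSingles {x y z} (xyz-distinct : Unique (x ∷ y ∷ z ∷ []))
                      (xyz≤N : All (_≤ N) (x ∷ y ∷ z ∷ []))
                      (ex : 1 ≤ e x) (ey : 1 ≤ e y) (ez : 1 ≤ e z) where

    no-other-chip : ∀ {w} → w ≤ N → All (w ≢_) (x ∷ y ∷ z ∷ []) → 1 ≤ e w → ⊥
    no-other-chip w≤N w∉xyz ew =
      overfull (w∉xyz ∷ xyz-distinct) (w≤N ∷ xyz≤N) (ew ∷ ex ∷ ey ∷ ez ∷ [])

    empty-elsewhere : ∀ {w} → w ≤ N → All (w ≢_) (x ∷ y ∷ z ∷ []) → e w ≡ 0
    empty-elsewhere {w} w≤N w∉xyz = ℕP.n≤0⇒n≡0
      (remaining (e w) (budget (w∉xyz ∷ xyz-distinct) (w≤N ∷ xyz≤N)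
                               (ℕP.≤-refl ∷ ex ∷ ey ∷ ez ∷ [])))

    no-double : ∀ {w} → w ≤ N → 2 ≤ e w → ⊥
    no-double {w} w≤N 2≤ew with w ℕ.≟ x | w ℕ.≟ y | w ℕ.≟ z
    ... | yes refl | _        | _        = overfull xyz-distinct xyz≤N (2≤ew ∷ ey ∷ ez ∷ [])
    ... | no _     | yes refl | _        = overfull xyz-distinct xyz≤N (ex ∷ 2≤ew ∷ ez ∷ [])
    ... | no _     | no _     | yes refl = overfull xyz-distinct xyz≤N (ex ∷ ey ∷ 2≤ew ∷ [])
    ... | no w≢x   | no w≢y   | no w≢z   = no-other-chip w≤N (w≢x ∷ w≢y ∷ w≢z ∷ []) (ℕP.<⇒≤ 2≤ew)

    -- Without a double chip only the four complement shapes remain.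
    refute : ∀ {q} → FiringShape m e q →
             (q ≡ 6 + m → 1 ≤ e (4 + m) → 1 ≤ e (5 + m) → ⊥) →
             (q ≡ 1 → 1 ≤ e 0 → 1 ≤ e 2 → 1 ≤ e 3 → ⊥) →
             (q ≡ 0 → 1 ≤ e 1 → 1 ≤ e 2 → ⊥) →
             (q ≡ 5 + m → 1 ≤ e (3 + m) → 1 ≤ e (4 + m) → 1 ≤ e (6 + m) → ⊥) → ⊥
    refute (first 2≤e0)                   _ _ _ _ = no-double z≤n 2≤e0
    refute (prefix t 3+t≤N _ _ 2≤e1+t)    _ _ _ _ = no-double (ℕP.m+n≤o⇒n≤o 2 3+t≤N) 2≤e1+t
    refute (allButLast q≡ e4+m e5+m)      k _ _ _ = k q≡ e4+m e5+m
    refute (second 3≤e1)                  _ _ _ _ = no-double (vertex 1) (ℕP.<⇒≤ 3≤e1)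
    refute (allButSecond q≡ e0 e2 e3)     _ k _ _ = k q≡ e0 e2 e3
    refute (last 2≤eN)                    _ _ _ _ = no-double ℕP.≤-refl 2≤eN
    refute (suffix k _ 1+k≤N _ 2≤ek _)    _ _ _ _ = no-double (ℕP.<⇒≤ 1+k≤N) 2≤ek
    refute (allButFirst q≡ e1 e2)         _ _ k _ = k q≡ e1 e2
    refute (penultimate 3≤e5+m)           _ _ _ _ = no-double (ℕP.n≤1+n _) (ℕP.<⇒≤ 3≤e5+m)
    refute (allButPenultimate q≡ e3 e4 e6) _ _ _ k = k q≡ e3 e4 e6

  module DoubleSingle {x y} (y≢x : y ≢ x) (x≤N : x ≤ N) (y≤N : y ≤ N)
                      (ex : 2 ≤ e x) (ey : 1 ≤ e y) where

    no-other-chip : ∀ {w} → w ≤ N → w ≢ x → w ≢ y → 1 ≤ e w → ⊥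
    no-other-chip w≤N w≢x w≢y ew = overfull ((w≢x ∷ w≢y ∷ []) ∷ (y≢x ∘ sym ∷ []) ∷ [] ∷ [])
                                            (w≤N ∷ x≤N ∷ y≤N ∷ []) (ew ∷ ex ∷ ey ∷ [])

    empty-elsewhere : ∀ {w} → w ≤ N → w ≢ x → w ≢ y → e w ≡ 0
    empty-elsewhere {w} w≤N w≢x w≢y = ℕP.n≤0⇒n≡0 (remaining (e w)
      (budget ((w≢x ∷ w≢y ∷ []) ∷ (y≢x ∘ sym ∷ []) ∷ [] ∷ [])
              (w≤N ∷ x≤N ∷ y≤N ∷ []) (ℕP.≤-refl ∷ ex ∷ ey ∷ [])))

    no-double-elsewhere : ∀ {w} → w ≤ N → w ≢ x → 2 ≤ e w → ⊥
    no-double-elsewhere {w} w≤N w≢x 2≤ew with w ℕ.≟ y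
    ... | yes refl = overfull ((y≢x ∘ sym ∷ []) ∷ [] ∷ []) (x≤N ∷ y≤N ∷ []) (ex ∷ 2≤ew ∷ [])
    ... | no w≢y   = no-other-chip w≤N w≢x w≢y (ℕP.<⇒≤ 2≤ew)

module Firing (m : ℕ) {D : Divisor (strip (6 + m))} (R : RankOneDegree≤3 (6 + m) D)
              (s : ℕ → Bool) where
  open RankOneDegree≤3 R

  D′ : Divisor (strip (6 + m))
  D′ v = D v -ᶻ laplacian (strip (6 + m)) (χℕ s ∘ toℕ) v

  -- At a concrete vertex this normalises to a numeral, so the hypotheses on it below hold by refl.
  outflow : Fin (7 + m) → ℤ
  outflow v = neighbourSum _+ᶻ_ (restrict (7 + m) (λ j → χℕ s (toℕ v) -ᶻ χℕ s j)) (toℕ v)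

  D′≡ : ∀ v → D′ v ≡ + chips D (toℕ v) -ᶻ outflow v
  D′≡ v = cong₂ _-ᶻ_ (sym (chips-toℕ effective v)) (laplacian-strip (6 + m) (χℕ s) v)

  gains : ∀ v k → outflow v ≡ - + k → Effective {strip (6 + m)} D′ → k ≤ chips D′ (toℕ v)
  gains v k outflow≡-k D′≥0 = subst (k ≤_) (sym (ℤP.+-injective (begin
    + chips D′ (toℕ v)                 ≡⟨ chips-toℕ D′≥0 v ⟩
    D′ v                               ≡⟨ D′≡ v ⟩
    + chips D (toℕ v) -ᶻ outflow v     ≡⟨ cong (λ o → + chips D (toℕ v) -ᶻ o) outflow≡-k ⟩
    + chips D (toℕ v) -ᶻ - + k
      ≡⟨ cong (+ chips D (toℕ v) +ᶻ_) (ℤP.neg-involutive (+ k)) ⟩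
    + (chips D (toℕ v) + k)            ∎))) (ℕP.m≤n+m k _)
    where open ≡-Reasoning

  loses : ∀ v k → outflow v ≡ + k → k ≤ chips D (toℕ v) → + 0 ≤ᶻ D′ v
  loses v k outflow≡k k≤chips =
    subst (+ 0 ≤ᶻ_) (sym (trans (D′≡ v) (cong (λ o → + chips D (toℕ v) -ᶻ o) outflow≡k)))
          (ℤP.i≤j⇒0≤j-i (ℤ.+≤+ k≤chips))

  unfired : ∀ v → s (toℕ v) ≡ false → + 0 ≤ᶻ D′ v
  unfired v v∉s = 0≤i-j (effective v) (sumFin-nonpos λ w → indicator-nonpos (adj (strip (6 + m)) v w)
    (subst (λ x → indicator x (+ 1) -ᶻ χℕ s (toℕ w) ≤ᶻ + 0) (sym v∉s)
           (ℤP.i≤j⇒i-j≤0 (indicator-nonneg (s (toℕ w)) (ℤ.+≤+ z≤n)))))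

  fired : Effective {strip (6 + m)} D′ → RankOneDegree≤3 (6 + m) D′
  fired = fire R (χℕ s ∘ toℕ)

¬singles-x-2-3 : ∀ m {D} (R : RankOneDegree≤3 (6 + m) D) {x} → x ≤ 1 →
                 1 ≤ chips D x → 1 ≤ chips D 2 → 1 ≤ chips D 3 → ⊥
¬singles-x-2-3 m R {x} x≤1 ex e2 e3 =
  refute (shape N ℕP.≤-refl (empty-elsewhere ℕP.≤-refl (≢x (s≤s (s≤s z≤n)) ∷ (λ ()) ∷ (λ ()) ∷ [])))
    (λ _ _ e5+m → no-other-chip (ℕP.n≤1+n _) (≢x (s≤s (s≤s z≤n)) ∷ (λ ()) ∷ (λ ()) ∷ []) e5+m)
    (λ ()) (λ ()) (λ N≡5+m _ _ _ → ℕP.1+n≢n N≡5+m)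
  where
  open Configuration m R
  x<2 : x < 2
  x<2 = s≤s x≤1
  ≢x : ∀ {w} → 2 ≤ w → w ≢ x
  ≢x 2≤w = ℕP.>⇒≢ (ℕP.<-≤-trans x<2 2≤w)
  open ThreeSingles ((ℕP.<⇒≢ x<2 ∷ ℕP.<⇒≢ (ℕP.m<n⇒m<1+n x<2) ∷ []) ∷ distinct (2 ∷ 3 ∷ []))
                    (ℕP.≤-trans x≤1 (vertex 1) ∷ vertex 2 ∷ vertex 3 ∷ []) ex e2 e3

¬singles-0-and-end : ∀ m {D} (R : RankOneDegree≤3 (6 + m) D) →
                     1 ≤ chips D 0 → 1 ≤ chips D (4 + m) → 1 ≤ chips D (5 + m) → ⊥
¬singles-0-and-end m R e0 e4+m e5+m =
  refute (shape 1 (vertex 1) (empty-elsewhere (vertex 1) ((λ ()) ∷ (λ ()) ∷ (λ ()) ∷ [])))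
    (λ ()) (λ _ _ e2 _ → no-other-chip (vertex 2) ((λ ()) ∷ (λ ()) ∷ (λ ()) ∷ []) e2) (λ ()) (λ ())
  where
  open Configuration m R
  open ThreeSingles (((λ ()) ∷ (λ ()) ∷ []) ∷ ((ℕP.<⇒≢ ℕP.≤-refl) ∷ []) ∷ [] ∷ [])
                    (z≤n ∷ ℕP.m≤n+m _ 2 ∷ ℕP.m≤n+m _ 1 ∷ []) e0 e4+m e5+m

¬double-single : ∀ m {D} (R : RankOneDegree≤3 (6 + m) D) {x} → 2 ≤ x → 2 + x ≤ 5 + m →
                 2 ≤ chips D x → 1 ≤ chips D (1 + x) → ⊥
¬double-single m R {x} 2≤x 2+x≤5+m ex e1+x = impossible (shape N ℕP.≤-refl
  (empty-elsewhere ℕP.≤-refl (ℕP.>⇒≢ (ℕP.<-trans (ℕP.n<1+n x) 1+x<N)) (ℕP.>⇒≢ 1+x<N)))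
  where
  open Configuration m R
  1+x<N : 1 + x < N
  1+x<N = ℕP.m<n⇒m<1+n 2+x≤5+m
  1+x≤N : 1 + x ≤ N
  1+x≤N = ℕP.<⇒≤ 1+x<N
  open DoubleSingle ℕP.1+n≢n (ℕP.<⇒≤ (ℕP.<-trans (ℕP.n<1+n x) 1+x<N)) 1+x≤N ex e1+x
  below : ∀ {w} → w < x → 1 ≤ e w → ⊥
  below w<x = no-other-chip (ℕP.<⇒≤ (ℕP.<-trans w<x (ℕP.<-trans (ℕP.n<1+n x) 1+x<N)))
                            (ℕP.<⇒≢ w<x) (ℕP.<⇒≢ (ℕP.m<n⇒m<1+n w<x))
  beyond : ∀ {w} → w ≤ N → 1 + x < w → 1 ≤ e w → ⊥
  beyond w≤N 1+x<w = no-other-chip w≤N (ℕP.>⇒≢ (ℕP.<-trans (ℕP.n<1+n x) 1+x<w)) (ℕP.>⇒≢ 1+x<w)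
  impossible : FiringShape m e N → ⊥
  impossible (first 2≤e0)                 = below (ℕP.<-≤-trans (s≤s z≤n) 2≤x) (ℕP.<⇒≤ 2≤e0)
  impossible (prefix t 3+t≤N _ et e1+t) with 1 + t ℕ.≟ x
  ... | yes refl = below ℕP.≤-refl et
  ... | no 1+t≢x = no-double-elsewhere (ℕP.m+n≤o⇒n≤o 2 3+t≤N) 1+t≢x e1+t
  impossible (allButLast _ _ e5+m)        = beyond (ℕP.n≤1+n _) 2+x≤5+m e5+m
  impossible (second 3≤e1)                = below 2≤x (ℕP.<⇒≤ (ℕP.<⇒≤ 3≤e1))
  impossible (allButSecond () _ _ _)
  impossible (last 2≤eN)                  = beyond ℕP.≤-refl 1+x<N (ℕP.<⇒≤ 2≤eN)
  impossible (suffix k _ 1+k≤N N<k _ _)   = ℕP.<⇒≱ N<k (ℕP.<⇒≤ 1+k≤N)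
  impossible (allButFirst () _ _)
  impossible (penultimate 3≤e5+m)         = beyond (ℕP.n≤1+n _) 2+x≤5+m (ℕP.<⇒≤ (ℕP.<⇒≤ 3≤e5+m))
  impossible (allButPenultimate N≡5+m _ _ _) = ℕP.1+n≢n N≡5+m

¬single-double : ∀ m {D} (R : RankOneDegree≤3 (6 + m) D) {t} → 2 ≤ t → 3 + t ≤ 6 + m →
                 1 ≤ chips D t → 2 ≤ chips D (1 + t) → ⊥
¬single-double m R {t} 2≤t 3+t≤N et e1+t =
  impossible (shape 0 z≤n (empty-elsewhere z≤n (λ ()) (ℕP.<⇒≢ 0<t)))
  where
  open Configuration m R
  0<t : 0 < t
  0<t = ℕP.<-≤-trans (s≤s z≤n) 2≤t
  open DoubleSingle (ℕP.<⇒≢ ℕP.≤-refl) (ℕP.m+n≤o⇒n≤o 2 3+t≤N) (ℕP.m+n≤o⇒n≤o 3 3+t≤N) e1+t et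
  below : ∀ {w} → w < t → 1 ≤ e w → ⊥
  below w<t = no-other-chip (ℕP.<⇒≤ (ℕP.<-≤-trans w<t (ℕP.m+n≤o⇒n≤o 3 3+t≤N)))
                            (ℕP.<⇒≢ (ℕP.m<n⇒m<1+n w<t)) (ℕP.<⇒≢ w<t)
  beyond : ∀ {w} → w ≤ N → 1 + t < w → 1 ≤ e w → ⊥
  beyond w≤N 1+t<w = no-other-chip w≤N (ℕP.>⇒≢ 1+t<w) (ℕP.>⇒≢ (ℕP.<-trans (ℕP.n<1+n t) 1+t<w))
  impossible : FiringShape m e 0 → ⊥
  impossible (first 2≤e0)                   = below 0<t (ℕP.<⇒≤ 2≤e0)
  impossible (prefix _ _ () _ _)
  impossible (allButLast () _ _)
  impossible (second 3≤e1)                  = below 2≤t (ℕP.<⇒≤ (ℕP.<⇒≤ 3≤e1))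
  impossible (allButSecond () _ _ _)
  impossible (last 2≤eN)                    =
    beyond ℕP.≤-refl (ℕP.m<n⇒m<1+n (ℕP.≤-pred 3+t≤N)) (ℕP.<⇒≤ 2≤eN)
  impossible (suffix k _ 1+k≤N _ 2≤ek e1+k) with k ℕ.≟ 1 + t
  ... | yes refl = beyond 1+k≤N ℕP.≤-refl e1+k
  ... | no k≢1+t = no-double-elsewhere (ℕP.<⇒≤ 1+k≤N) k≢1+t 2≤ek
  impossible (allButFirst _ e1 _)           = below 2≤t e1
  impossible (penultimate 3≤e5+m)           =
    beyond (ℕP.n≤1+n _) (ℕP.≤-pred 3+t≤N) (ℕP.<⇒≤ (ℕP.<⇒≤ 3≤e5+m))
  impossible (allButPenultimate () _ _ _)

¬triple-at-1 : ∀ m {D} (R : RankOneDegree≤3 (6 + m) D) → 3 ≤ chips D 1 → ⊥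
¬triple-at-1 m R 3≤e1 =
  ¬singles-x-2-3 m (fired D′≥0) z≤n
    (gains 0F 1 refl D′≥0) (gains 2F 1 refl D′≥0) (gains 3F 1 refl D′≥0)
  where
  open Firing m R (_≡ᵇ 1)
  D′≥0 : Effective {strip (6 + m)} D′
  D′≥0 0F            = unfired 0F refl
  D′≥0 1F            = loses 1F 3 refl 3≤e1
  D′≥0 (suc (suc w)) = unfired (suc (suc w)) refl

¬prefix-pattern : ∀ m {D} (R : RankOneDegree≤3 (6 + m) D) t → 3 + t ≤ 6 + m →
                  1 ≤ chips D t → 2 ≤ chips D (1 + t) → ⊥
¬prefix-pattern m R zero _ e0 e1 =
  ¬double-single m (fired D′≥0) ℕP.≤-refl (ℕP.m≤m+n 4 (1 + m))
    (gains 2F 2 refl D′≥0) (gains 3F 1 refl D′≥0)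
  where
  open Firing m R (_≤ᵇ 1)
  D′≥0 : Effective {strip (6 + m)} D′
  D′≥0 0F            = loses 0F 1 refl e0
  D′≥0 1F            = loses 1F 2 refl e1
  D′≥0 (suc (suc w)) = unfired (suc (suc w)) refl
¬prefix-pattern m R (suc zero) _ e1 e2 =
  ¬double-single m (fired D′≥0) (s≤s (s≤s z≤n)) (ℕP.m≤m+n 5 m)
    (gains 3F 2 refl D′≥0) (gains 4F 1 refl D′≥0)
  where
  open Firing m R (_≤ᵇ 2)
  D′≥0 : Effective {strip (6 + m)} D′
  D′≥0 0F                  = loses 0F 0 refl z≤n
  D′≥0 1F                  = loses 1F 1 refl e1
  D′≥0 2F                  = loses 2F 2 refl e2
  D′≥0 (suc (suc (suc w))) = unfired (suc (suc (suc w))) refl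
¬prefix-pattern m R t@(suc (suc _)) 3+t≤N et e1+t = ¬single-double m R (s≤s (s≤s z≤n)) 3+t≤N et e1+t

¬singles-1-2-empty-3 : ∀ m {D} (R : RankOneDegree≤3 (6 + m) D) →
                       1 ≤ chips D 1 → 1 ≤ chips D 2 → chips D 2 ≤ 1 → chips D 3 ≡ 0 → ⊥
¬singles-1-2-empty-3 m R e1 e2 e2≤1 e3≡0 = impossible (shape 3 (vertex 3) e3≡0)
  where
  open Configuration m R
  double-beyond-3 : ∀ {w} → w ≤ N → 3 < w → 2 ≤ e w → ⊥
  double-beyond-3 w≤N 3<w 2≤ew = overfull
    (((λ ()) ∷ ℕP.<⇒≢ (ℕP.<-trans (s≤s (s≤s z≤n)) 3<w) ∷ []) ∷ (ℕP.<⇒≢ (ℕP.<-trans ℕP.≤-refl 3<w) ∷ []) ∷ [] ∷ [])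
    (vertex 1 ∷ vertex 2 ∷ w≤N ∷ []) (e1 ∷ e2 ∷ 2≤ew ∷ [])
  impossible : FiringShape m e 3 → ⊥
  impossible (first 2≤e0)                      = overfull-at (0 ∷ 1 ∷ 2 ∷ []) (2≤e0 ∷ e1 ∷ e2 ∷ [])
  impossible (prefix zero _ _ e0 2≤e1)         = overfull-at (0 ∷ 1 ∷ 2 ∷ []) (e0 ∷ 2≤e1 ∷ e2 ∷ [])
  impossible (prefix (suc zero) _ _ _ 2≤e2)    = ℕP.<⇒≱ 2≤e2 e2≤1
  impossible (prefix (suc (suc _)) _ (s≤s (s≤s (s≤s ()))) _ _)
  impossible (allButLast () _ _)
  impossible (second 3≤e1)                     = overfull-at (1 ∷ 2 ∷ []) (3≤e1 ∷ e2 ∷ [])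
  impossible (allButSecond () _ _ _)
  impossible (last 2≤eN)                       = double-beyond-3 ℕP.≤-refl (s≤s (s≤s (s≤s (s≤s z≤n)))) 2≤eN
  impossible (suffix k _ 1+k≤N 3<k 2≤ek _)     = double-beyond-3 (ℕP.<⇒≤ 1+k≤N) 3<k 2≤ek
  impossible (allButFirst () _ _)
  impossible (penultimate 3≤e5+m)              =
    double-beyond-3 (ℕP.n≤1+n _) (s≤s (s≤s (s≤s (s≤s z≤n)))) (ℕP.<⇒≤ 3≤e5+m)
  impossible (allButPenultimate () _ _ _)

¬double-at-0 : ∀ m {D} (R : RankOneDegree≤3 (6 + m) D) → 2 ≤ chips D 0 → ⊥
¬double-at-0 m R 2≤e0 = continue (2 ℕP.≤? chips D′ 2) (chips D′ 3 ℕ.≟ 0)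
  where
  open Firing m R (_≤ᵇ 0)
  D′≥0 : Effective {strip (6 + m)} D′
  D′≥0 0F      = loses 0F 2 refl 2≤e0
  D′≥0 (suc w) = unfired (suc w) refl
  R′ : RankOneDegree≤3 (6 + m) D′
  R′ = fired D′≥0
  e′1 : 1 ≤ chips D′ 1
  e′1 = gains 1F 1 refl D′≥0
  e′2 : 1 ≤ chips D′ 2
  e′2 = gains 2F 1 refl D′≥0
  continue : Dec (2 ≤ chips D′ 2) → Dec (chips D′ 3 ≡ 0) → ⊥
  continue (yes 2≤e′2) _            = ¬prefix-pattern m R′ 1 (vertex 4) e′1 2≤e′2
  continue (no  2≰e′2) (yes e′3≡0) =
    ¬singles-1-2-empty-3 m R′ e′1 e′2 (ℕP.≤-pred (ℕP.≰⇒> 2≰e′2)) e′3≡0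
  continue (no  _)     (no  e′3≢0) = ¬singles-x-2-3 m R′ ℕP.≤-refl e′1 e′2 (ℕP.n≢0⇒n>0 e′3≢0)

¬singles-end : ∀ m {D} (R : RankOneDegree≤3 (6 + m) D) →
               1 ≤ chips D (4 + m) → 1 ≤ chips D (5 + m) → ⊥
¬singles-end m {D} R e4+m e5+m with chips D 0 ℕ.≟ 0
... | no  e0≢0 = ¬singles-0-and-end m R (ℕP.n≢0⇒n>0 e0≢0) e4+m e5+m
... | yes e0≡0 = impossible (shape 0 z≤n e0≡0)
  where
  open Configuration m R
  4+m≤N : 4 + m ≤ N
  4+m≤N = ℕP.m≤n+m _ 2
  ends-distinct : Unique (4 + m ∷ 5 + m ∷ [])
  ends-distinct = (ℕP.<⇒≢ ℕP.≤-refl ∷ []) ∷ [] ∷ []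
  double-off-ends : ∀ {w} → w ≤ N → w ≢ 4 + m → w ≢ 5 + m → 2 ≤ e w → ⊥
  double-off-ends w≤N w≢4+m w≢5+m 2≤ew = overfull ((w≢4+m ∷ w≢5+m ∷ []) ∷ ends-distinct)
    (w≤N ∷ 4+m≤N ∷ ℕP.n≤1+n _ ∷ []) (2≤ew ∷ e4+m ∷ e5+m ∷ [])
  impossible : FiringShape m e 0 → ⊥
  impossible (first 2≤e0)   = ℕP.<⇒≱ 2≤e0 (ℕP.≤-trans (ℕP.≤-reflexive e0≡0) z≤n)
  impossible (prefix _ _ () _ _)
  impossible (allButLast () _ _)
  impossible (second 3≤e1)  = double-off-ends (vertex 1) (λ ()) (λ ()) (ℕP.<⇒≤ 3≤e1)
  impossible (allButSecond () _ _ _)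
  impossible (last 2≤eN)    =
    double-off-ends ℕP.≤-refl (ℕP.>⇒≢ (ℕP.m<n⇒m<1+n ℕP.≤-refl)) (ℕP.>⇒≢ ℕP.≤-refl) 2≤eN
  impossible (suffix k _ 1+k≤N _ 2≤ek e1+k) with k ℕ.≟ 4 + m | k ℕ.≟ 5 + m
  ... | yes refl | _        = ¬prefix-pattern m (reflect R) 1 (vertex 4)
                                (mirrored D (vertex 1) e1+k) (mirrored D (vertex 2) 2≤ek)
  ... | no _     | yes refl = overfull
    ((ℕP.<⇒≢ ℕP.≤-refl ∷ ℕP.<⇒≢ (ℕP.m<n⇒m<1+n ℕP.≤-refl) ∷ []) ∷ (ℕP.<⇒≢ ℕP.≤-refl ∷ []) ∷ [] ∷ [])
    (4+m≤N ∷ ℕP.n≤1+n _ ∷ ℕP.≤-refl ∷ []) (e4+m ∷ 2≤ek ∷ e1+k ∷ [])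
  ... | no k≢4+m | no k≢5+m = double-off-ends (ℕP.<⇒≤ 1+k≤N) k≢4+m k≢5+m 2≤ek
  impossible (allButFirst _ e1 e2) = overfull
    (((λ ()) ∷ (λ ()) ∷ (λ ()) ∷ []) ∷ ((λ ()) ∷ (λ ()) ∷ []) ∷ ends-distinct)
    (vertex 1 ∷ vertex 2 ∷ 4+m≤N ∷ ℕP.n≤1+n _ ∷ []) (e1 ∷ e2 ∷ e4+m ∷ e5+m ∷ [])
  impossible (penultimate 3≤e5+m) =
    overfull ends-distinct (4+m≤N ∷ ℕP.n≤1+n _ ∷ []) (e4+m ∷ 3≤e5+m ∷ [])
  impossible (allButPenultimate () _ _ _)

¬rankOneDegree≤3 : ∀ m {D} → RankOneDegree≤3 (6 + m) D → ⊥
¬rankOneDegree≤3 m {D} R = excluded empty-vertex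
  where
  open Configuration m R
  R′ : RankOneDegree≤3 (6 + m) (D ∘ opposite)
  R′ = reflect R

  empty-vertex : ∃[ q ] (q ≤ 3 × e q ≡ 0)
  empty-vertex with e 0 ℕ.≟ 0 | e 1 ℕ.≟ 0 | e 2 ℕ.≟ 0 | e 3 ℕ.≟ 0
  ... | yes e0≡0 | _        | _        | _        = 0 , z≤n , e0≡0
  ... | no _     | yes e1≡0 | _        | _        = 1 , s≤s z≤n , e1≡0
  ... | no _     | no _     | yes e2≡0 | _        = 2 , s≤s (s≤s z≤n) , e2≡0
  ... | no _     | no _     | no _     | yes e3≡0 = 3 , ℕP.≤-refl , e3≡0
  ... | no e0≢0  | no e1≢0  | no e2≢0  | no e3≢0  = ⊥-elim (overfull-at (0 ∷ 1 ∷ 2 ∷ 3 ∷ [])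
    (ℕP.n≢0⇒n>0 e0≢0 ∷ ℕP.n≢0⇒n>0 e1≢0 ∷ ℕP.n≢0⇒n>0 e2≢0 ∷ ℕP.n≢0⇒n>0 e3≢0 ∷ []))

  refute-shape : ∀ {q} → FiringShape m e q → ⊥
  refute-shape (first 2≤e0)                      = ¬double-at-0 m R 2≤e0
  refute-shape (prefix t 3+t≤N _ et e1+t)        = ¬prefix-pattern m R t 3+t≤N et e1+t
  refute-shape (allButLast _ e4+m e5+m)          = ¬singles-end m R e4+m e5+m
  refute-shape (second 3≤e1)                     = ¬triple-at-1 m R 3≤e1
  refute-shape (allButSecond _ e0 e2 e3)         = ¬singles-x-2-3 m R z≤n e0 e2 e3
  refute-shape (last 2≤eN)                       = ¬double-at-0 m R′ (mirrored D z≤n 2≤eN)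
  refute-shape (suffix k 2≤k 1+k≤N _ 2≤ek e1+k) =
    ¬prefix-pattern m R′ t 3+t≤N
      (mirrored D (ℕP.m+n≤o⇒n≤o 3 3+t≤N) (subst (λ i → 1 ≤ e i) (sym N∸t≡1+k) e1+k))
      (mirrored D (ℕP.m+n≤o⇒n≤o 2 3+t≤N) (subst (λ i → 2 ≤ e i) (sym N∸1+t≡k) 2≤ek))
    where
    k≤5+m : k ≤ 5 + m
    k≤5+m = ℕP.≤-pred 1+k≤N
    t : ℕ
    t = 5 + m ∸ k
    3+t≤N : 3 + t ≤ N
    3+t≤N = ℕP.+-monoʳ-≤ 3 (ℕP.∸-monoʳ-≤ (5 + m) 2≤k)
    N∸1+t≡k : N ∸ (1 + t) ≡ k
    N∸1+t≡k = ℕP.m∸[m∸n]≡n k≤5+m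
    N∸t≡1+k : N ∸ t ≡ 1 + k
    N∸t≡1+k = trans (ℕP.+-∸-assoc 1 (ℕP.m∸n≤m (5 + m) k)) (cong suc N∸1+t≡k)
  refute-shape (allButFirst _ e1 e2)             =
    ¬singles-end m R′ (mirrored D (ℕP.m≤n+m _ 2) (subst (λ i → 1 ≤ e i) (sym (ℕP.m+n∸n≡m 2 m)) e2))
                      (mirrored D (ℕP.n≤1+n _) (subst (λ i → 1 ≤ e i) (sym (ℕP.m+n∸n≡m 1 m)) e1))
  refute-shape (penultimate 3≤e5+m)              = ¬triple-at-1 m R′ (mirrored D (vertex 1) 3≤e5+m)
  refute-shape (allButPenultimate _ e3+m e4+m e6+m) =
    ¬singles-x-2-3 m R′ z≤n
      (mirrored D z≤n e6+m) (mirrored D (vertex 2) e4+m) (mirrored D (vertex 3) e3+m)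

  excluded : ∃[ q ] (q ≤ 3 × e q ≡ 0) → ⊥
  excluded (q , q≤3 , eq≡0) = refute-shape (shape q (ℕP.≤-trans q≤3 (vertex 3)) eq≡0)

rank≥1⇒deg≥4 : ∀ m {D : Divisor (strip (6 + m))} → RankAtLeast {strip (6 + m)} D 1 →
               + 4 ≤ᶻ deg {strip (6 + m)} D
rank≥1⇒deg≥4 m {D} rank≥1 with + 4 ℤ.≤? sumFin D | proj₁ rank≥1
... | yes 4≤degD | _                  = 4≤degD
... | no  4≰degD | D₀ , D₀≥0 , D∼D₀ = ⊥-elim (¬rankOneDegree≤3 m record
  { effective = D₀≥0
  ; deg≤3     = subst (_≤ᶻ + 3) (∼⇒deg≡ (strip (6 + m)) (strip-symmetric (6 + m)) {D} {D₀} D∼D₀)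
                      (ℤP.i<j⇒i≤pred[j] (ℤP.≰⇒> 4≰degD))
  ; reaches   = reachesEveryVertex-resp-∼ (strip (6 + m)) {D} {D₀} D∼D₀
                  (rank≥1⇒reachesEveryVertex {strip (6 + m)} {D} rank≥1)
  })

theorem5p13 : (n : ℕ) → 6 ≤ n → GonalityAtLeast (strip n) (+ 4)
theorem5p13 n 6≤n with m , refl ← ℕP.m≤n⇒∃[o]m+o≡n 6≤n = λ D → rank≥1⇒deg≥4 m {D}
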